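{- Let $\Gamma(V,E)$ be a finite graph with vertex set $V$, edge set $E$, and $c$ connected components. For $k=0,1,2,3$, let $\mathcal{L}(k)$ be the set of ordered pairs $(A,B)$ of subsets of $E$ such that the symmetric difference $A\,\Delta\, B$ is a disjoint union of minimal cutsets of $\Gamma$ and $|A|+|B|\equiv |E|+k \pmod 4$; and let $\bar{\mathcal{L}}(k)$ be the set of ordered pairs $(A,B)$ of subsets of $E$ such that $A\,\Delta\,B$ is a disjoint union of cycles of $\Gamma$ and $|A|+|B|\equiv |E|+k \pmod 4$. Then $$|\mathcal{L}(1)|=|\mathcal{L}(3)| \quad\text{and}\quad |\mathcal{L}(0)|-|\mathcal{L}(2)| = 2^{|E|-c}P(\Gamma;2),$$ $$|\bar{\mathcal{L}}(1)|=|\bar{\mathcal{L}}(3)| \quad\text{and}\quad |\bar{\mathcal{L}}(0)|-|\bar{\mathcal{L}}(2)| = 2^{|E|}F(\Gamma;2),$$ where $P(\Gamma;\lambda)$ is the chromatic polynomial and $F(\Gamma;\lambda)$ is the flow polynomial of $\Gamma$.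
   Context: A minimal cutset of a graph is a minimal nonempty set of edges whose removal increases the number of connected components; the empty set counts as a (trivial) disjoint union of minimal cutsets, and likewise of cycles. The flow polynomial $F(\Gamma;\lambda)$ evaluated at a positive integer $\lambda$ is the number of nowhere-zero flows on $\Gamma$ (for any fixed orientation) with values in an Abelian group of order $\lambda$. -}

module Defs where

open import Data.Nat using (ℕ; zero; suc; _+_; _<_)
open import Data.Nat.DivMod using (_mod_)
open import Data.Integer as ℤ using (ℤ; +_; _-_)
open import Data.Integer.Divisibility using () renaming (_∣_ to _∣ℤ_)
open import Data.Bool using (Bool; true; false; _xor_)
open import Data.Fin using (Fin; zero; suc; toℕ; _≟_)
open import Relation.Nullary using (yes; no)
open import Data.Fin.Subset using (Subset; _∈_; _⊆_; ∁; ⊤; ⊥; _∩_; ⋃; ∣_∣; Nonempty; Empty)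
open import Data.Vec using (Vec; zipWith)
open import Data.List using (List; length)
open import Data.List.Relation.Unary.All using (All)
open import Data.List.Relation.Unary.AllPairs using (AllPairs)
open import Data.List.Relation.Unary.Unique.Propositional using (Unique)
open import Data.List.Membership.Propositional using () renaming (_∈_ to _∈ˡ_)
open import Data.Product using (Σ; ∃; _×_; _,_; proj₁; proj₂)
open import Data.Sum using (_⊎_)
open import Relation.Binary.PropositionalEquality using (_≡_; _≢_)
open import Relation.Binary.Construct.Closure.ReflexiveTransitive using (Star)
open import Function.Bundles using (_⇔_)

-- Finite (multi)graphs: vertices Fin n, edges Fin m, each edge e has an
-- ordered pair of endpoints (tail , head) = a fixed orientation.
-- Loops and parallel edges are allowed.

record Graph : Set where
  field
    nV    : ℕ
    nE    : ℕ
    ends  : Fin nE → Fin nV × Fin nV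

open Graph public

tail head : (G : Graph) → Fin (nE G) → Fin (nV G)
tail G e = proj₁ (ends G e)
head G e = proj₂ (ends G e)

Joins : (G : Graph) → Fin (nE G) → Fin (nV G) → Fin (nV G) → Set
Joins G e u v = (tail G e ≡ u × head G e ≡ v) ⊎ (tail G e ≡ v × head G e ≡ u)

EdgeSet : Graph → Set
EdgeSet G = Subset (nE G)

-- Cardinality of a subset {x | P x} of a type with decidable equality:
-- a duplicate-free list enumerating exactly the elements satisfying P.

HasSize : {X : Set} → (X → Set) → ℕ → Set
HasSize {X} P N =
  Σ (List X) λ xs → Unique xs × length xs ≡ N × (∀ x → (x ∈ˡ xs) ⇔ P x)

Adj : (G : Graph) → EdgeSet G → Fin (nV G) → Fin (nV G) → Set
Adj G T u v = Σ (Fin (nE G)) λ e → e ∈ T × Joins G e u v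

Connected : (G : Graph) → EdgeSet G → Fin (nV G) → Fin (nV G) → Set
Connected G T = Star (Adj G T)

-- The spanning subgraph (V, T) has exactly c connected components:
-- there is a surjective labelling of vertices by Fin c whose fibres are
-- exactly the connectivity classes.
NumComponents : (G : Graph) → EdgeSet G → ℕ → Set
NumComponents G T c =
  Σ (Fin (nV G) → Fin c) λ comp →
    (∀ i → ∃ λ u → comp u ≡ i) ×
    (∀ u v → (comp u ≡ comp v) ⇔ Connected G T u v)

IncreasesComponents : (G : Graph) → EdgeSet G → Set
IncreasesComponents G S =
  Σ ℕ λ c → Σ ℕ λ c' →
    NumComponents G ⊤ c × NumComponents G (∁ S) c' × c < c'

MinimalCutset : (G : Graph) → EdgeSet G → Set
MinimalCutset G S =
  Nonempty S × IncreasesComponents G S ×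
  (∀ T → T ⊆ S → Nonempty T → IncreasesComponents G T → T ≡ S)

-- Cycles: edge set of a closed walk v₀ e₀ v₁ e₁ … v_k e_k v₀ with
-- pairwise distinct vertices and pairwise distinct edges (length k+1 ≥ 1;
-- loops are cycles of length 1, two parallel edges a cycle of length 2).

csuc : ∀ {k} → Fin (suc k) → Fin (suc k)
csuc {k} i = suc (toℕ i) mod (suc k)

Cycle : (G : Graph) → EdgeSet G → Set
Cycle G S =
  Σ ℕ λ k → Σ (Fin (suc k) → Fin (nV G)) λ vs → Σ (Fin (suc k) → Fin (nE G)) λ es →
    (∀ i j → vs i ≡ vs j → i ≡ j) ×
    (∀ i j → es i ≡ es j → i ≡ j) ×
    (∀ i → Joins G (es i) (vs i) (vs (csuc i))) ×
    (∀ e → (e ∈ S) ⇔ (∃ λ i → es i ≡ e))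

Disjoint : ∀ {m} → Subset m → Subset m → Set
Disjoint A B = Empty (A ∩ B)

DisjointUnionOf : ∀ {m} → (Subset m → Set) → Subset m → Set
DisjointUnionOf {m} P S =
  Σ (List (Subset m)) λ Ts → All P Ts × AllPairs Disjoint Ts × ⋃ Ts ≡ S

_Δ_ : ∀ {m} → Subset m → Subset m → Subset m
A Δ B = zipWith _xor_ A B

SizeCond : (G : Graph) → ℕ → EdgeSet G × EdgeSet G → Set
SizeCond G k (A , B) = (∣ A ∣ + ∣ B ∣) mod 4 ≡ (nE G + k) mod 4

𝓛 : (G : Graph) → ℕ → EdgeSet G × EdgeSet G → Set
𝓛 G k (A , B) = DisjointUnionOf (MinimalCutset G) (A Δ B) × SizeCond G k (A , B)

𝓛̄ : (G : Graph) → ℕ → EdgeSet G × EdgeSet G → Set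
𝓛̄ G k (A , B) = DisjointUnionOf (Cycle G) (A Δ B) × SizeCond G k (A , B)

-- Chromatic polynomial at a positive integer λ: number of proper
-- λ-colourings (colourings as vectors indexed by vertices).

ProperColouring : (G : Graph) → (λ' : ℕ) → Vec (Fin λ') (nV G) → Set
ProperColouring G λ' col =
  ∀ e → Data.Vec.lookup col (tail G e) ≢ Data.Vec.lookup col (head G e)

ChromaticValue : Graph → ℕ → ℕ → Set
ChromaticValue G λ' N = HasSize (ProperColouring G λ') N

-- Flow polynomial at λ: number of nowhere-zero flows with values in the
-- Abelian group ℤ/λ (w.r.t. the fixed orientation given by ends).

∑ : ∀ {m} → (Fin m → ℤ) → ℤ
∑ {zero}  f = + 0
∑ {suc m} f = f zero ℤ.+ ∑ (λ i → f (suc i))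

ifEq : ∀ {n} → Fin n → Fin n → ℤ → ℤ
ifEq u v z with u ≟ v
... | yes _ = z
... | no  _ = + 0

netFlow : (G : Graph) → {λ' : ℕ} → Vec (Fin λ') (nE G) → Fin (nV G) → ℤ
netFlow G f v =
  ∑ (λ e → ifEq (tail G e) v (+ toℕ (Data.Vec.lookup f e)))
  - ∑ (λ e → ifEq (head G e) v (+ toℕ (Data.Vec.lookup f e)))

NowhereZeroFlow : (G : Graph) → (λ' : ℕ) → Vec (Fin λ') (nE G) → Set
NowhereZeroFlow G λ' f =
  (∀ e → toℕ (Data.Vec.lookup f e) ≢ 0) ×
  (∀ v → (+ λ') ∣ℤ netFlow G f v)

FlowValue : Graph → ℕ → ℕ → Set
FlowValue G λ' N = HasSize (NowhereZeroFlow G λ') N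

module Submission where

-- Both halves are instances of one counting fact about ordered pairs
-- (A , B) of edge sets whose symmetric difference has a property Q
-- (PairCount): the involution τ, flipping both memberships at the first
-- edge where A and B agree, keeps A Δ B and shifts |A| + |B| by ± 2.  It
-- matches 𝓛(1) with 𝓛(3) and 𝓛(0) with 𝓛(2), except for the 2 ^ |E| pairs
-- (A , ∁ A), which lie in 𝓛(0) exactly when Q holds for E.  So
-- |𝓛(0)| - |𝓛(2)| is 2 ^ |E| or 0 according as Q(E), and it remains to
-- evaluate the polynomials at 2:
--  * E is a disjoint union of minimal cutsets iff E is a cut iff G has a
--    proper 2-colouring, and then P(G; 2) = 2 ^ c (Cuts, TwoColourings);
--  * E is a disjoint union of cycles iff all degrees are even (Degrees,
--    Veblen) iff the constant 1, the only nowhere-zero ℤ/2-valued function,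
--    is a flow; so F(G; 2) is 1 or 0 accordingly (Flows).

open import Defs
open import Data.Nat using (ℕ; zero; suc; _+_; _*_; _^_; _∸_; _≤_; _<_; s≤s; z≤n; _%_)
open import Data.Nat.Properties
  using (≤-antisym; ≤-refl; ≤-trans; <-trans; <-≤-trans; ≤-<-trans; <-cmp; <⇒≢; <-irrefl; ≤-pred; n<1+n;
         m≤n⇒m<n∨m≡n; +-suc; +-comm; +-identityʳ; *-comm; *-zeroʳ; *-identityʳ; +-monoʳ-≤;
         +-cancelˡ-≡; m+[n∸m]≡n; +-0-commutativeMonoid)
open import Data.Nat.Divisibility using (_∣_; divides; ∣m∣n⇒∣m+n; ∣m+n∣m⇒∣n)
open import Data.Integer.Divisibility using () renaming (_∣_ to _∣ℤ_)
open import Data.Nat.DivMod using (_mod_; %-distribˡ-+; [m+n]%n≡m%n; m%n<n; m<n⇒m%n≡m; n%n≡0)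
open import Data.Bool using (Bool; true; false; not; _xor_; _∨_)
import Data.Bool.Properties as Bool
open import Data.Unit using (tt) renaming (⊤ to Unit)
open import Data.Fin using (Fin; zero; suc; toℕ; punchOut; punchIn)
import Data.Fin as Fin
open import Data.Fin.Properties
  using (toℕ-fromℕ<; toℕ-injective; suc-injective; toℕ-inject₁; toℕ-fromℕ; toℕ<n; punchOut-cong; punchOut-injective; punchOut-punchIn; punchInᵢ≢i;
         injective⇒≤; any?; all?; ¬∀⟶∃¬; pigeonhole)
open import Data.Fin.Subset using (Subset; ⊤; ⊥; ∁; ∣_∣; _∈_; _∉_; _⊆_; _⊂_; _∪_; _∩_; ⋃; Nonempty)
open import Data.Fin.Subset.Properties
  using (_∈?_; _⊆?_; ∈⊤; ∉⊥; x∈∁p⇒x∉p; x∉p⇒x∈∁p; anySubset?; nonempty?; Empty-unique; ⊆-antisym; p⊂q⇒∣p∣<∣q∣; x∈p∪q⁺; x∈p∪q⁻; x∈p∩q⁺; x∈p∩q⁻)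
open import Data.Vec using (Vec; []; _∷_; lookup; tabulate)
open import Data.Vec.Properties using ([]=⇒lookup; lookup⇒[]=; tabulate∘lookup; tabulate-cong; lookup-zipWith; lookup∘tabulate; lookup-replicate)
import Data.Vec.Properties as Vec
open import Data.List using (List; []; _∷_; _++_; length; map)
open import Data.List.Relation.Unary.Any using (here; there)
open import Data.List.Relation.Unary.All using (All; []; _∷_)
import Data.List.Relation.Unary.All as All
open import Data.List.Relation.Unary.AllPairs using (AllPairs; []; _∷_)
open import Data.List.Relation.Unary.Unique.Propositional using (Unique)
import Data.List.Relation.Unary.Unique.Propositional.Properties as Unique
open import Data.List.Membership.Propositional using () renaming (_∈_ to _∈ˡ_)
open import Data.List.Membership.Propositional.Properties using (∈-∃++; ∈-map⁺; ∈-map⁻; ∈-++⁺ˡ; ∈-++⁺ʳ; ∈-++⁻)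
import Data.List.Membership.DecPropositional as DecMembership
open import Data.List.Properties using (length-++; length-map)
open import Data.Product using (Σ; ∃; ∃₂; _×_; _,_; proj₁; proj₂)
open import Data.Sum using (_⊎_; inj₁; inj₂; [_,_]′)
import Data.Sum.Properties as Sum
import Data.Product.Properties as Product
open import Data.Empty using (⊥-elim)
open import Relation.Nullary using (¬_; Dec; yes; no; does; ¬?; _×-dec_; _⊎-dec_)
open import Relation.Binary.Definitions using (DecidableEquality; tri<; tri≈; tri>)
open import Relation.Nullary.Decidable using (_→-dec_; dec-true)
open import Relation.Binary.Construct.Closure.ReflexiveTransitive using (Star; ε; _◅_; _◅◅_; _⋆; fold)
import Relation.Binary.Construct.Closure.ReflexiveTransitive as Star
import Data.Empty
open import Relation.Binary.PropositionalEquality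
open import Function.Bundles using (_⇔_; Equivalence; mk⇔)

open Equivalence using (to; from)

-- Counting with HasSize: all counts are compared through injections.

module Counting where

  ∈-remove : ∀ {X : Set} {z w : X} (ys₁ ys₂ : List X) → z ∈ˡ ys₁ ++ w ∷ ys₂ → z ≢ w → z ∈ˡ ys₁ ++ ys₂
  ∈-remove []        ys₂ (here z≡w) z≢w = ⊥-elim (z≢w z≡w)
  ∈-remove []        ys₂ (there p)  _   = p
  ∈-remove (y ∷ ys₁) ys₂ (here p)   _   = here p
  ∈-remove (y ∷ ys₁) ys₂ (there p)  z≢w = there (∈-remove ys₁ ys₂ p z≢w)

  length-remove : ∀ {X : Set} (ys₁ : List X) w ys₂ → length (ys₁ ++ w ∷ ys₂) ≡ suc (length (ys₁ ++ ys₂))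
  length-remove []        w ys₂ = refl
  length-remove (y ∷ ys₁) w ys₂ = cong suc (length-remove ys₁ w ys₂)

  All≢⇒∉ : ∀ {X : Set} {x y : X} {xs : List X} → All (x ≢_) xs → y ∈ˡ xs → x ≢ y
  All≢⇒∉ (x≢y ∷ _)  (here refl) = x≢y
  All≢⇒∉ (_   ∷ ps) (there q)   = All≢⇒∉ ps q

  injection⇒length≤ : ∀ {X Y : Set} {xs : List X} {ys : List Y} → Unique xs → (f : X → Y) →
    (∀ {x} → x ∈ˡ xs → f x ∈ˡ ys) →
    (∀ {x y} → x ∈ˡ xs → y ∈ˡ xs → f x ≡ f y → x ≡ y) → length xs ≤ length ys
  injection⇒length≤ {xs = []} _ _ _ _ = z≤n
  injection⇒length≤ {xs = x ∷ xs} {ys} (x∉xs ∷ uniq) f f∈ f-inj with ∈-∃++ (f∈ (here refl))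
  ... | ys₁ , ys₂ , refl =
    subst (suc (length xs) ≤_) (sym (length-remove ys₁ (f x) ys₂))
      (s≤s (injection⇒length≤ uniq f
        (λ y∈ → ∈-remove ys₁ ys₂ (f∈ (there y∈))
                  (λ fy≡fx → All≢⇒∉ x∉xs y∈ (sym (f-inj (there y∈) (here refl) fy≡fx))))
        (λ p q → f-inj (there p) (there q))))

  module _ {X Y : Set} where

    size≤length : ∀ {P : X → Set} {a} → HasSize P a → (ys : List Y) → (f : X → Y) →
      (∀ x → P x → f x ∈ˡ ys) → (∀ x y → P x → P y → f x ≡ f y → x ≡ y) → a ≤ length ys
    size≤length (xs , uniq , refl , mem) ys f f∈ f-inj =
      injection⇒length≤ uniq f (λ {x} x∈ → f∈ x (to (mem x) x∈))
        (λ {x} {y} p q → f-inj x y (to (mem x) p) (to (mem y) q))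

    length≤size : ∀ {Q : Y → Set} {b} (xs : List X) → Unique xs → HasSize Q b → (f : X → Y) →
      (∀ {x} → x ∈ˡ xs → Q (f x)) → (∀ {x y} → x ∈ˡ xs → y ∈ˡ xs → f x ≡ f y → x ≡ y) → length xs ≤ b
    length≤size xs uniq (ys , _ , refl , mem) f fQ f-inj =
      injection⇒length≤ uniq f (λ x∈ → from (mem _) (fQ x∈)) f-inj

    size≤size : ∀ {P : X → Set} {Q : Y → Set} {a b} → HasSize P a → HasSize Q b → (f : X → Y) →
      (∀ x → P x → Q (f x)) → (∀ x y → P x → P y → f x ≡ f y → x ≡ y) → a ≤ b
    size≤size HP (ys , _ , refl , mem) f fQ f-inj =
      size≤length HP ys f (λ x p → from (mem (f x)) (fQ x p)) f-inj

  size-≡ : ∀ {X Y : Set} {P : X → Set} {Q : Y → Set} {a b} → HasSize P a → HasSize Q b →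
    (f : X → Y) → (∀ x → P x → Q (f x)) → (∀ x y → P x → P y → f x ≡ f y → x ≡ y) →
    (g : Y → X) → (∀ y → Q y → P (g y)) → (∀ x y → Q x → Q y → g x ≡ g y → x ≡ y) → a ≡ b
  size-≡ HP HQ f fQ f-inj g gP g-inj = ≤-antisym (size≤size HP HQ f fQ f-inj) (size≤size HQ HP g gP g-inj)

  size-empty : ∀ {X : Set} {P : X → Set} {a} → HasSize P a → (∀ x → ¬ P x) → a ≡ 0
  size-empty ([]     , _ , refl , _)   _  = refl
  size-empty (x ∷ xs , _ , refl , mem) ¬P = ⊥-elim (¬P x (to (mem x) (here refl)))

  size⇒dec : ∀ {X : Set} {P : X → Set} {a} → DecidableEquality X → HasSize P a → ∀ x → Dec (P x)
  size⇒dec _≟_ (xs , _ , _ , mem) x with x ∈ˡ? xs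
    where open DecMembership _≟_ using () renaming (_∈?_ to _∈ˡ?_)
  ... | yes x∈ = yes (to (mem x) x∈)
  ... | no  x∉ = no (λ p → x∉ (from (mem x) p))

  size-⊎ : ∀ {X Y : Set} {P : X → Set} {Q : Y → Set} {a b} → HasSize P a → HasSize Q b →
    HasSize {X ⊎ Y} [ P , Q ]′ (a + b)
  size-⊎ {X} {Y} {P} {Q} (xs , uniq₁ , refl , mem₁) (ys , uniq₂ , refl , mem₂) =
    map inj₁ xs ++ map inj₂ ys ,
    Unique.++⁺ (Unique.map⁺ Sum.inj₁-injective uniq₁) (Unique.map⁺ Sum.inj₂-injective uniq₂) disjoint ,
    trans (length-++ (map inj₁ xs)) (cong₂ _+_ (length-map inj₁ xs) (length-map inj₂ ys)) ,
    λ { (inj₁ x) → mk⇔ (λ p → to (mem₁ x) (from-inj₁ p)) (λ p → ∈-++⁺ˡ (∈-map⁺ inj₁ (from (mem₁ x) p)))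
      ; (inj₂ y) → mk⇔ (λ p → to (mem₂ y) (from-inj₂ p)) (λ p → ∈-++⁺ʳ (map inj₁ xs) (∈-map⁺ inj₂ (from (mem₂ y) p))) }
    where
    disjoint : ∀ {v} → ¬ (v ∈ˡ map inj₁ xs × v ∈ˡ map inj₂ ys)
    disjoint (p , q) with ∈-map⁻ inj₁ p | ∈-map⁻ inj₂ q
    ... | _ , _ , refl | _ , _ , ()
    from-inj₁ : ∀ {x} → inj₁ x ∈ˡ map inj₁ xs ++ map inj₂ ys → x ∈ˡ xs
    from-inj₁ p with ∈-++⁻ (map inj₁ xs) p
    ... | inj₁ q with ∈-map⁻ inj₁ q
    ...   | _ , x∈ , refl = x∈
    from-inj₁ p | inj₂ q with ∈-map⁻ inj₂ q
    ...   | _ , _ , ()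
    from-inj₂ : ∀ {y} → inj₂ y ∈ˡ map inj₁ xs ++ map inj₂ ys → y ∈ˡ ys
    from-inj₂ p with ∈-++⁻ (map inj₁ xs) p
    ... | inj₁ q with ∈-map⁻ inj₁ q
    ...   | _ , _ , ()
    from-inj₂ p | inj₂ q with ∈-map⁻ inj₂ q
    ...   | _ , y∈ , refl = y∈

  allSubsets : ∀ m → List (Subset m)
  allSubsets zero    = [] ∷ []
  allSubsets (suc m) = map (true ∷_) (allSubsets m) ++ map (false ∷_) (allSubsets m)

  allSubsets-size : ∀ m → HasSize {Subset m} (λ _ → Unit) (2 ^ m)
  allSubsets-size m = allSubsets m , unique m , length≡ m , λ A → mk⇔ (λ _ → tt) (λ _ → complete A)
    where
    unique : ∀ m → Unique (allSubsets m)
    unique zero    = [] ∷ []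
    unique (suc m) = Unique.++⁺ (Unique.map⁺ Vec.∷-injectiveʳ (unique m)) (Unique.map⁺ Vec.∷-injectiveʳ (unique m)) disjoint
      where
      disjoint : ∀ {v} → ¬ (v ∈ˡ map (true ∷_) (allSubsets m) × v ∈ˡ map (false ∷_) (allSubsets m))
      disjoint (p , q) with ∈-map⁻ (true ∷_) p | ∈-map⁻ (false ∷_) q
      ... | _ , _ , refl | _ , _ , ()
    length≡ : ∀ m → length (allSubsets m) ≡ 2 ^ m
    length≡ zero    = refl
    length≡ (suc m) = begin
      length (map (true ∷_) (allSubsets m) ++ map (false ∷_) (allSubsets m))
        ≡⟨ length-++ (map (true ∷_) (allSubsets m)) ⟩
      length (map (true ∷_) (allSubsets m)) + length (map (false ∷_) (allSubsets m))
        ≡⟨ cong₂ _+_ (length-map (true ∷_) (allSubsets m)) (length-map (false ∷_) (allSubsets m)) ⟩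
      length (allSubsets m) + length (allSubsets m)
        ≡⟨ cong₂ _+_ (length≡ m) (trans (length≡ m) (sym (+-identityʳ (2 ^ m)))) ⟩
      2 ^ suc m ∎
      where open ≡-Reasoning
    complete : ∀ {m} (A : Subset m) → A ∈ˡ allSubsets m
    complete []                = here refl
    complete {suc m} (true ∷ A)  = ∈-++⁺ˡ (∈-map⁺ (true ∷_) (complete A))
    complete {suc m} (false ∷ A) = ∈-++⁺ʳ (map (true ∷_) (allSubsets m)) (∈-map⁺ (false ∷_) (complete A))

module PairInvolution where

  Pair : ℕ → Set
  Pair m = Subset m × Subset m

  diff : ∀ {m} → Pair m → Subset m
  diff (A , B) = A Δ B

  weight : ∀ {m} → Pair m → ℕ
  weight (A , B) = ∣ A ∣ + ∣ B ∣

  cons : ∀ {m} → Bool → Bool → Pair m → Pair (suc m)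
  cons a b (A , B) = a ∷ A , b ∷ B

  τ : ∀ {m} → Pair m → Pair m
  τ ([]        , [])        = [] , []
  τ (true ∷ A  , true ∷ B)  = false ∷ A , false ∷ B
  τ (false ∷ A , false ∷ B) = true ∷ A , true ∷ B
  τ (true ∷ A  , false ∷ B) = cons true false (τ (A , B))
  τ (false ∷ A , true ∷ B)  = cons false true (τ (A , B))

  τ-involutive : ∀ {m} (p : Pair m) → τ (τ p) ≡ p
  τ-involutive ([]        , [])        = refl
  τ-involutive (true ∷ A  , true ∷ B)  = refl
  τ-involutive (false ∷ A , false ∷ B) = refl
  τ-involutive (true ∷ A  , false ∷ B) = cong (cons true false) (τ-involutive (A , B))
  τ-involutive (false ∷ A , true ∷ B)  = cong (cons false true) (τ-involutive (A , B))

  τ-injective : ∀ {m} (p q : Pair m) → τ p ≡ τ q → p ≡ q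
  τ-injective p q eq = trans (sym (τ-involutive p)) (trans (cong τ eq) (τ-involutive q))

  τ-diff : ∀ {m} (p : Pair m) → diff (τ p) ≡ diff p
  τ-diff ([]        , [])        = refl
  τ-diff (true ∷ A  , true ∷ B)  = refl
  τ-diff (false ∷ A , false ∷ B) = refl
  τ-diff (true ∷ A  , false ∷ B) = cong (true ∷_) (τ-diff (A , B))
  τ-diff (false ∷ A , true ∷ B)  = cong (true ∷_) (τ-diff (A , B))

  weight-cons-ft : ∀ {m} (p : Pair m) → weight (cons false true p) ≡ suc (weight p)
  weight-cons-ft (A , B) = +-suc ∣ A ∣ ∣ B ∣

  TwoApart : ℕ → ℕ → Set
  TwoApart s s' = s' ≡ 2 + s ⊎ s ≡ 2 + s'

  suc-TwoApart : ∀ {s s'} → TwoApart s s' → TwoApart (suc s) (suc s')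
  suc-TwoApart (inj₁ eq) = inj₁ (cong suc eq)
  suc-TwoApart (inj₂ eq) = inj₂ (cong suc eq)

  τ-weight : ∀ {m} (p : Pair m) → diff p ≢ ⊤ → TwoApart (weight p) (weight (τ p))
  τ-weight ([]        , [])        d≢⊤ = ⊥-elim (d≢⊤ refl)
  τ-weight (true ∷ A  , true ∷ B)  _   = inj₂ (cong suc (+-suc ∣ A ∣ ∣ B ∣))
  τ-weight (false ∷ A , false ∷ B) _   = inj₁ (cong suc (+-suc ∣ A ∣ ∣ B ∣))
  τ-weight (true ∷ A  , false ∷ B) d≢⊤ = suc-TwoApart (τ-weight (A , B) (λ d≡⊤ → d≢⊤ (cong (true ∷_) d≡⊤)))
  τ-weight (false ∷ A , true ∷ B)  d≢⊤ =
    subst₂ TwoApart (sym (weight-cons-ft (A , B))) (sym (weight-cons-ft (τ (A , B))))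
      (suc-TwoApart (τ-weight (A , B) (λ d≡⊤ → d≢⊤ (cong (true ∷_) d≡⊤))))

  diff⊤⇒weight : ∀ {m} (p : Pair m) → diff p ≡ ⊤ → weight p ≡ m
  diff⊤⇒weight ([]        , [])        _  = refl
  diff⊤⇒weight (true ∷ A  , false ∷ B) eq = cong suc (diff⊤⇒weight (A , B) (Vec.∷-injectiveʳ eq))
  diff⊤⇒weight (false ∷ A , true ∷ B)  eq =
    trans (weight-cons-ft (A , B)) (cong suc (diff⊤⇒weight (A , B) (Vec.∷-injectiveʳ eq)))
  diff⊤⇒weight (true ∷ A  , true ∷ B)  ()
  diff⊤⇒weight (false ∷ A , false ∷ B) ()

  Δ-∁ : ∀ {m} (A : Subset m) → A Δ ∁ A ≡ ⊤
  Δ-∁ []          = refl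
  Δ-∁ (true ∷ A)  = cong (true ∷_) (Δ-∁ A)
  Δ-∁ (false ∷ A) = cong (true ∷_) (Δ-∁ A)

  Δ-cancelˡ : ∀ {m} (A B C : Subset m) → A Δ B ≡ A Δ C → B ≡ C
  Δ-cancelˡ []      []      []      _  = refl
  Δ-cancelˡ (a ∷ A) (b ∷ B) (c ∷ C) eq =
    cong₂ _∷_ (xor-cancelˡ a (Vec.∷-injectiveˡ eq)) (Δ-cancelˡ A B C (Vec.∷-injectiveʳ eq))
    where
    xor-cancelˡ : ∀ a {b c} → a xor b ≡ a xor c → b ≡ c
    xor-cancelˡ true  {b} {c} e = trans (sym (Bool.not-involutive b)) (trans (cong not e) (Bool.not-involutive c))
    xor-cancelˡ false e = e

module Mod4 where

  infix 4 _≡₄_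
  _≡₄_ : ℕ → ℕ → Set
  a ≡₄ b = a % 4 ≡ b % 4

  mod⇒≡₄ : ∀ a b → a mod 4 ≡ b mod 4 → a ≡₄ b
  mod⇒≡₄ a b e = trans (sym (toℕ-fromℕ< (m%n<n a 4))) (trans (cong toℕ e) (toℕ-fromℕ< (m%n<n b 4)))

  ≡₄⇒mod : ∀ a b → a ≡₄ b → a mod 4 ≡ b mod 4
  ≡₄⇒mod a b e = toℕ-injective (trans (toℕ-fromℕ< (m%n<n a 4)) (trans e (sym (toℕ-fromℕ< (m%n<n b 4)))))

  2+-cong : ∀ a b → a ≡₄ b → 2 + a ≡₄ 2 + b
  2+-cong a b e = trans (%-distribˡ-+ 2 a 4) (trans (cong (λ z → (2 % 4 + z) % 4) e) (sym (%-distribˡ-+ 2 b 4)))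

  4+≡₄ : ∀ a → 2 + (2 + a) ≡₄ a
  4+≡₄ a = trans (cong (_% 4) (+-comm 4 a)) ([m+n]%n≡m%n a 4)

  TwoApart⇒≡₄ : ∀ {s s'} → PairInvolution.TwoApart s s' → s' ≡₄ 2 + s
  TwoApart⇒≡₄ (inj₁ refl) = refl
  TwoApart⇒≡₄ {s' = s'} (inj₂ refl) = sym (4+≡₄ s')

  ≢₄-shift : ∀ m k → 0 < k → k < 4 → ¬ (m ≡₄ m + k)
  ≢₄-shift m k 0<k k<4 e = residue-shift (m % 4) k (m%n<n m 4) 0<k k<4
    (trans e (trans (%-distribˡ-+ m k 4) (cong (λ z → (m % 4 + z) % 4) (m<n⇒m%n≡m k<4))))
    where
    residue-shift : ∀ r k → r < 4 → 0 < k → k < 4 → r ≢ (r + k) % 4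
    residue-shift 0 1 _ _ _ ()
    residue-shift 0 2 _ _ _ ()
    residue-shift 0 3 _ _ _ ()
    residue-shift 1 1 _ _ _ ()
    residue-shift 1 2 _ _ _ ()
    residue-shift 1 3 _ _ _ ()
    residue-shift 2 1 _ _ _ ()
    residue-shift 2 2 _ _ _ ()
    residue-shift 2 3 _ _ _ ()
    residue-shift 3 1 _ _ _ ()
    residue-shift 3 2 _ _ _ ()
    residue-shift 3 3 _ _ _ ()
    residue-shift r 0 _ () _
    residue-shift r (suc (suc (suc (suc k)))) _ _ (s≤s (s≤s (s≤s (s≤s ()))))
    residue-shift (suc (suc (suc (suc r)))) _ (s≤s (s≤s (s≤s (s≤s ())))) _ _

-- Cond k is 𝓛(k) for Q = "disjoint union of
-- minimal cutsets" and 𝓛̄(k) for Q = "disjoint union of cycles".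
-- τ matches Cond 1 with Cond 3 and, away from the pairs (A , ∁ A),
-- Cond 0 with Cond 2; the 2 ^ m pairs (A , ∁ A) lie in Cond 0 iff Q ⊤.

module PairCount (m : ℕ) (Q : Subset m → Set) where
  open Counting
  open PairInvolution
  open Mod4

  Cond : ℕ → Pair m → Set
  Cond k p = Q (diff p) × weight p mod 4 ≡ (m + k) mod 4

  +-TwoApart : ∀ n {k k'} → TwoApart k k' → TwoApart (n + k) (n + k')
  +-TwoApart zero    kk' = kk'
  +-TwoApart (suc n) kk' = suc-TwoApart (+-TwoApart n kk')

  TwoApart-sym : ∀ {k k'} → TwoApart k k' → TwoApart k' k
  TwoApart-sym (inj₁ eq) = inj₂ eq
  TwoApart-sym (inj₂ eq) = inj₁ eq

  -- A pair with A Δ B = ⊤ has weight m, so it lies in no Cond k with k = 1, 2, 3.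
  diff≢⊤ : ∀ k → 0 < k → k < 4 → ∀ p → Cond k p → diff p ≢ ⊤
  diff≢⊤ k 0<k k<4 p (_ , w≡) d≡⊤ =
    ≢₄-shift m k 0<k k<4 (trans (cong (_% 4) (sym (diff⊤⇒weight p d≡⊤))) (mod⇒≡₄ (weight p) (m + k) w≡))

  τ-Cond : ∀ {k k'} → TwoApart k k' → ∀ p → Cond k p → diff p ≢ ⊤ → Cond k' (τ p)
  τ-Cond {k} {k'} kk' p (q , w≡) d≢⊤ = subst Q (sym (τ-diff p)) q , ≡₄⇒mod (weight (τ p)) (m + k') weight≡₄
    where
    weight≡₄ : weight (τ p) ≡₄ m + k'
    weight≡₄ = trans (TwoApart⇒≡₄ (τ-weight p d≢⊤))
               (trans (2+-cong (weight p) (m + k) (mod⇒≡₄ (weight p) (m + k) w≡))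
                      (sym (TwoApart⇒≡₄ (+-TwoApart m kk'))))

  τ-size-≡ : ∀ {k k' a b} → TwoApart k k' →
    (∀ p → Cond k p → diff p ≢ ⊤) → (∀ p → Cond k' p → diff p ≢ ⊤) →
    HasSize (Cond k) a → HasSize (Cond k') b → a ≡ b
  τ-size-≡ kk' ≢⊤ ≢⊤' Ha Hb =
    size-≡ Ha Hb τ (λ p c → τ-Cond kk' p c (≢⊤ p c)) (λ p q _ _ → τ-injective p q)
                 τ (λ p c → τ-Cond (TwoApart-sym kk') p c (≢⊤' p c)) (λ p q _ _ → τ-injective p q)

  odd-classes : ∀ {a b} → HasSize (Cond 1) a → HasSize (Cond 3) b → a ≡ b
  odd-classes = τ-size-≡ (inj₁ refl) (diff≢⊤ 1 (s≤s z≤n) (s≤s (s≤s z≤n)))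
                                     (diff≢⊤ 3 (s≤s z≤n) (s≤s (s≤s (s≤s (s≤s z≤n)))))

  Cond2≢⊤ : ∀ p → Cond 2 p → diff p ≢ ⊤
  Cond2≢⊤ = diff≢⊤ 2 (s≤s z≤n) (s≤s (s≤s (s≤s z≤n)))

  complement-Cond : Q ⊤ → ∀ A → Cond 0 (A , ∁ A)
  complement-Cond q A = subst Q (sym (Δ-∁ A)) q ,
    ≡₄⇒mod (weight (A , ∁ A)) (m + 0) (cong (_% 4) (trans (diff⊤⇒weight (A , ∁ A) (Δ-∁ A)) (sym (+-identityʳ m))))

  -- Q ⊤ is decided by whether (⊤ , ∁ ⊤) is among the listed elements of Cond 0.
  Q⊤? : ∀ {a} → HasSize (Cond 0) a → Dec (Q ⊤)
  Q⊤? H₀ with size⇒dec (Product.≡-dec (Vec.≡-dec Bool._≟_) (Vec.≡-dec Bool._≟_)) H₀ (⊤ , ∁ ⊤)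
  ... | yes c = yes (subst Q (Δ-∁ ⊤) (proj₁ c))
  ... | no ¬c = no (λ q → ¬c (complement-Cond q ⊤))

  even-classes-without-⊤ : ∀ {a b} → ¬ Q ⊤ → HasSize (Cond 0) a → HasSize (Cond 2) b → a ≡ b
  even-classes-without-⊤ ¬q = τ-size-≡ (inj₁ refl) (λ p c d≡⊤ → ¬q (subst Q d≡⊤ (proj₁ c))) Cond2≢⊤

  -- With Q ⊤, Cond 0 is in bijection with (all subsets A) ⊎ Cond 2:
  -- (A , ∁ A) ↔ A, and any other pair p ↔ τ p.
  even-classes-with-⊤ : ∀ {a b} → Q ⊤ → HasSize (Cond 0) a → HasSize (Cond 2) b → a ≡ 2 ^ m + b
  even-classes-with-⊤ q H₀ H₂ =
    size-≡ H₀ (size-⊎ (allSubsets-size m) H₂)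
      split (λ p c → split-Cond p c (diff? p)) (λ p p' _ _ → split-injective p p' (diff? p) (diff? p'))
      join join-Cond join-injective
    where
    Target : Subset m ⊎ Pair m → Set
    Target = [ (λ _ → Unit) , Cond 2 ]′

    diff? : (p : Pair m) → Dec (diff p ≡ ⊤)
    diff? p = Vec.≡-dec Bool._≟_ (diff p) ⊤

    splitBy : (p : Pair m) → Dec (diff p ≡ ⊤) → Subset m ⊎ Pair m
    splitBy p (yes _) = inj₁ (proj₁ p)
    splitBy p (no _)  = inj₂ (τ p)

    split : Pair m → Subset m ⊎ Pair m
    split p = splitBy p (diff? p)

    split-Cond : ∀ p → Cond 0 p → (d : Dec (diff p ≡ ⊤)) → Target (splitBy p d)
    split-Cond p c (yes _)   = tt
    split-Cond p c (no d≢⊤)  = τ-Cond (inj₁ refl) p c d≢⊤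

    split-injective : ∀ p p' (d : Dec (diff p ≡ ⊤)) (d' : Dec (diff p' ≡ ⊤)) → splitBy p d ≡ splitBy p' d' → p ≡ p'
    split-injective (A , B) (A' , B') (yes d≡⊤) (yes d'≡⊤) refl = cong (A ,_) (Δ-cancelˡ A B B' (trans d≡⊤ (sym d'≡⊤)))
    split-injective p p' (no _) (no _) eq = τ-injective p p' (Sum.inj₂-injective eq)
    split-injective p p' (yes _) (no _) ()
    split-injective p p' (no _) (yes _) ()

    join : Subset m ⊎ Pair m → Pair m
    join (inj₁ A) = A , ∁ A
    join (inj₂ p) = τ p

    join-Cond : ∀ z → Target z → Cond 0 (join z)
    join-Cond (inj₁ A) _ = complement-Cond q A
    join-Cond (inj₂ p) c = τ-Cond (inj₂ refl) p c (Cond2≢⊤ p c)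

    -- τ p never has the form (A , ∁ A), since diff (τ p) = diff p ≢ ⊤.
    τ≢complement : ∀ p A → Cond 2 p → τ p ≢ (A , ∁ A)
    τ≢complement p A c eq = Cond2≢⊤ p c (trans (sym (τ-diff p)) (trans (cong diff eq) (Δ-∁ A)))

    join-injective : ∀ z z' → Target z → Target z' → join z ≡ join z' → z ≡ z'
    join-injective (inj₁ A) (inj₁ A') _ _  eq = cong inj₁ (cong proj₁ eq)
    join-injective (inj₂ p) (inj₂ p') _ _  eq = cong inj₂ (τ-injective p p' eq)
    join-injective (inj₁ A) (inj₂ p)  _ c' eq = ⊥-elim (τ≢complement p A c' (sym eq))
    join-injective (inj₂ p) (inj₁ A)  c _  eq = ⊥-elim (τ≢complement p A c eq)

-- A "component
-- labelling" with c labels is a surjection onto Fin c whose fibres are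
-- the classes of the reflexive-transitive closure Star R; NumComponents
-- is the instance R = Adj G T.  Every R generated by finitely many
-- symmetric steps has one (adding a step merges at most two labels), and
-- comparing labellings of R ⊇ R' shows that R' has strictly more classes
-- iff some pair is R-connected but not R'-connected.

module Components {n : ℕ} where

  Relation : Set₁
  Relation = Fin n → Fin n → Set

  Labelling : Relation → ℕ → Set
  Labelling R c =
    Σ (Fin n → Fin c) λ comp → (∀ i → ∃ λ u → comp u ≡ i) × (∀ u v → (comp u ≡ comp v) ⇔ Star R u v)

  connected? : ∀ {R c} → Labelling R c → ∀ u v → Dec (Star R u v)
  connected? (comp , _ , classes) u v with comp u Fin.≟ comp v
  ... | yes e = yes (to (classes u v) e)
  ... | no ne = no (λ s → ne (from (classes u v) s))

  relabel : ∀ {R R' c} → Labelling R c → (∀ {u v} → R u v → Star R' u v) → (∀ {u v} → R' u v → Star R u v) → Labelling R' c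
  relabel (comp , onto , classes) R⇒R' R'⇒R =
    comp , onto , λ u v → mk⇔ (λ e → (R⇒R' ⋆) (to (classes u v) e)) (λ s → from (classes u v) ((R'⇒R ⋆) s))

  Empty : Relation
  Empty _ _ = Data.Empty.⊥

  identity-labelling : Labelling Empty n
  identity-labelling = (λ u → u) , (λ i → i , refl) , λ u v → mk⇔ (λ { refl → ε }) (λ { ε → refl ; (() ◅ _) })

  _+step_—_ : Relation → Fin n → Fin n → Relation
  (R +step a — b) u v = R u v ⊎ ((a ≡ u × b ≡ v) ⊎ (a ≡ v × b ≡ u))

  -- Identifying label β with label α, and renumbering into Fin c'.
  module Merge {c' : ℕ} (α β : Fin (suc c')) (α≢β : α ≢ β) where
    target : (i : Fin (suc c')) → Dec (i ≡ β) → Σ (Fin (suc c')) (β ≢_)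
    target i (yes _)  = α , (λ e → α≢β (sym e))
    target i (no i≢β) = i , (λ e → i≢β (sym e))

    redirect : Fin (suc c') → Fin (suc c')
    redirect i = proj₁ (target i (i Fin.≟ β))

    merge : Fin (suc c') → Fin c'
    merge i = punchOut (proj₂ (target i (i Fin.≟ β)))

    merge-≡ : ∀ i j → merge i ≡ merge j ⇔ redirect i ≡ redirect j
    merge-≡ i j = mk⇔ (punchOut-injective (proj₂ (target i (i Fin.≟ β))) (proj₂ (target j (j Fin.≟ β))))
                      (punchOut-cong β)

    redirect-≡ : ∀ i j → redirect i ≡ redirect j → i ≡ j ⊎ ((i ≡ β × j ≡ α) ⊎ (i ≡ α × j ≡ β))
    redirect-≡ i j e with i Fin.≟ β | j Fin.≟ β
    ... | yes p | yes q = inj₁ (trans p (sym q))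
    ... | yes p | no _  = inj₂ (inj₁ (p , sym e))
    ... | no _  | yes q = inj₂ (inj₂ (e , q))
    ... | no _  | no _  = inj₁ e

    redirect-α : redirect α ≡ α
    redirect-α with α Fin.≟ β
    ... | yes α≡β = ⊥-elim (α≢β α≡β)
    ... | no _    = refl

    redirect-β : redirect β ≡ α
    redirect-β with β Fin.≟ β
    ... | yes _   = refl
    ... | no β≢β  = ⊥-elim (β≢β refl)

    merge-αβ : merge α ≡ merge β
    merge-αβ = from (merge-≡ α β) (trans redirect-α (sym redirect-β))

    merge-onto : ∀ j → merge (punchIn β j) ≡ j
    merge-onto j with punchIn β j Fin.≟ β
    ... | yes p = ⊥-elim (punchInᵢ≢i β j p)
    ... | no _  = trans (punchOut-cong β refl) (punchOut-punchIn β)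

  labelling-+step : ∀ {R c} → Labelling R c → (a b : Fin n) → ∃ λ c' → Labelling (R +step a — b) c'
  labelling-+step {R} {c} (comp , onto , classes) a b with comp a Fin.≟ comp b
  ... | yes same = c , comp , onto , λ u v → mk⇔ (λ e → Star.map inj₁ (to (classes u v) e)) (fold _ (λ r e → trans (step r) e) refl)
    where
    step : ∀ {x y} → (R +step a — b) x y → comp x ≡ comp y
    step (inj₁ r)                    = from (classes _ _) (r ◅ ε)
    step (inj₂ (inj₁ (refl , refl))) = same
    step (inj₂ (inj₂ (refl , refl))) = sym same
  ... | no differ = merged c comp onto classes differ
    where
    merged : ∀ c (comp : Fin n → Fin c) → (∀ i → ∃ λ u → comp u ≡ i) → (∀ u v → (comp u ≡ comp v) ⇔ Star R u v) →
         comp a ≢ comp b → ∃ λ c' → Labelling (R +step a — b) c'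
    merged zero comp _ _ _ with comp a
    ... | ()
    merged (suc c') comp onto classes differ =
      c' , comp' , onto' , λ u v → mk⇔ (forth u v) (fold _ (λ r e → trans (step r) e) refl)
      where
      open Merge (comp a) (comp b) differ
      comp' : Fin n → Fin c'
      comp' u = merge (comp u)
      onto' : ∀ j → ∃ λ u → comp' u ≡ j
      onto' j with onto (punchIn (comp b) j)
      ... | u , eu = u , trans (cong merge eu) (merge-onto j)
      lift : ∀ {u v} → Star R u v → Star (R +step a — b) u v
      lift = Star.map inj₁
      forth : ∀ u v → comp' u ≡ comp' v → Star (R +step a — b) u v
      forth u v e with redirect-≡ (comp u) (comp v) (to (merge-≡ (comp u) (comp v)) e)
      ... | inj₁ e' = lift (to (classes u v) e')
      ... | inj₂ (inj₁ (u~b , v~a)) =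
        lift (to (classes u b) u~b) ◅◅ (inj₂ (inj₂ (refl , refl)) ◅ lift (to (classes a v) (sym v~a)))
      ... | inj₂ (inj₂ (u~a , v~b)) =
        lift (to (classes u a) u~a) ◅◅ (inj₂ (inj₁ (refl , refl)) ◅ lift (to (classes b v) (sym v~b)))
      step : ∀ {x y} → (R +step a — b) x y → comp' x ≡ comp' y
      step (inj₁ r)                    = cong merge (from (classes _ _) (r ◅ ε))
      step (inj₂ (inj₁ (refl , refl))) = merge-αβ
      step (inj₂ (inj₂ (refl , refl))) = sym merge-αβ

  injection-missing⇒< : ∀ {c c'} (s : Fin c → Fin c') → (∀ {i j} → s i ≡ s j → i ≡ j) → (x₀ : Fin c') → (∀ i → s i ≢ x₀) → c < c'
  injection-missing⇒< {c} {c'} s s-inj x₀ missing = injective⇒≤ {f = s₀} s₀-inj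
    where
    s₀ : Fin (suc c) → Fin c'
    s₀ zero    = x₀
    s₀ (suc i) = s i
    s₀-inj : ∀ {i j} → s₀ i ≡ s₀ j → i ≡ j
    s₀-inj {zero}  {zero}  _ = refl
    s₀-inj {zero}  {suc j} e = ⊥-elim (missing j (sym e))
    s₀-inj {suc i} {zero}  e = ⊥-elim (missing i e)
    s₀-inj {suc i} {suc j} e = cong suc (s-inj e)

  module Finer {R R' : Relation} {c c' : ℕ} (L : Labelling R c) (L' : Labelling R' c')
               (finer : ∀ {u v} → Star R' u v → Star R u v) where
    comp : Fin n → Fin c
    comp = proj₁ L
    comp' : Fin n → Fin c'
    comp' = proj₁ L'
    rep : Fin c → Fin n
    rep i = proj₁ (proj₁ (proj₂ L) i)
    rep-comp : ∀ i → comp (rep i) ≡ i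
    rep-comp i = proj₂ (proj₁ (proj₂ L) i)
    classes : ∀ u v → (comp u ≡ comp v) ⇔ Star R u v
    classes = proj₂ (proj₂ L)
    classes' : ∀ u v → (comp' u ≡ comp' v) ⇔ Star R' u v
    classes' = proj₂ (proj₂ L')

    -- each R-class contains a distinct R'-class
    refine : Fin c → Fin c'
    refine i = comp' (rep i)

    refine-back : ∀ i u → refine i ≡ comp' u → i ≡ comp u
    refine-back i u e = trans (sym (rep-comp i)) (from (classes _ _) (finer (to (classes' _ _) e)))

    refine-injective : ∀ {i j} → refine i ≡ refine j → i ≡ j
    refine-injective {i} {j} e = trans (refine-back i (rep j) e) (rep-comp j)

    separated⇒< : ∀ u v → Star R u v → ¬ Star R' u v → c < c'
    separated⇒< u v u~v ¬u~'v with refine (comp u) Fin.≟ comp' u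
    ... | yes e = injection-missing⇒< refine refine-injective (comp' v) missing
      where
      missing : ∀ i → refine i ≢ comp' v
      missing i e' = ¬u~'v (to (classes' u v) (trans (sym e) (trans (cong refine u≡i) e')))
        where
        u≡i : comp u ≡ i
        u≡i = trans (from (classes u v) u~v) (sym (refine-back i v e'))
    ... | no ne = injection-missing⇒< refine refine-injective (comp' u) missing
      where
      missing : ∀ i → refine i ≢ comp' u
      missing i e' = ne (trans (cong refine (sym (refine-back i u e'))) e')

    kept? : ∀ u v → Dec (comp u ≡ comp v → comp' u ≡ comp' v)
    kept? u v = (comp u Fin.≟ comp v) →-dec (comp' u Fin.≟ comp' v)

    <⇒separated : c < c' → ∃₂ λ u v → Star R u v × ¬ Star R' u v
    <⇒separated c<c' with all? (λ u → all? (λ v → kept? u v))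
    ... | yes kept = ⊥-elim (<-irrefl refl (≤-trans c<c' (injective⇒≤ {f = coarsen} coarsen-injective)))
      where
      coarsen : Fin c' → Fin c
      coarsen j = comp (proj₁ (proj₁ (proj₂ L') j))
      coarsen-injective : ∀ {i j} → coarsen i ≡ coarsen j → i ≡ j
      coarsen-injective {i} {j} e =
        trans (sym (proj₂ (proj₁ (proj₂ L') i))) (trans (kept _ _ e) (proj₂ (proj₁ (proj₂ L') j)))
    ... | no ¬kept with ¬∀⟶∃¬ n _ (λ u → all? (kept? u)) ¬kept
    ... | u , ¬kept-u with ¬∀⟶∃¬ n _ (kept? u) ¬kept-u
    ... | v , ¬kept-uv with comp u Fin.≟ comp v
    ... | yes same = u , v , to (classes u v) same , (λ s → ¬kept-uv (λ _ → from (classes' u v) s))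
    ... | no diff  = ⊥-elim (¬kept-uv (λ same → ⊥-elim (diff same)))

module GraphComponents (G : Graph) where
  open Components

  elements : ∀ {m} → Subset m → List (Fin m)
  elements []          = []
  elements (true ∷ p)  = zero ∷ map suc (elements p)
  elements (false ∷ p) = map suc (elements p)

  elements⁻ : ∀ {m} (p : Subset m) {e} → e ∈ˡ elements p → e ∈ p
  elements⁻ (true ∷ p) (here refl) = Data.Vec.here
  elements⁻ (true ∷ p) (there q) with ∈-map⁻ suc q
  ... | _ , q' , refl = Data.Vec.there (elements⁻ p q')
  elements⁻ (false ∷ p) q with ∈-map⁻ suc q
  ... | _ , q' , refl = Data.Vec.there (elements⁻ p q')

  elements⁺ : ∀ {m} (p : Subset m) {e} → e ∈ p → e ∈ˡ elements p
  elements⁺ (true ∷ p)  Data.Vec.here      = here refl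
  elements⁺ (true ∷ p)  (Data.Vec.there q) = there (∈-map⁺ suc (elements⁺ p q))
  elements⁺ (false ∷ p) (Data.Vec.there q) = ∈-map⁺ suc (elements⁺ p q)

  AdjList : List (Fin (nE G)) → Fin (nV G) → Fin (nV G) → Set
  AdjList es u v = Σ (Fin (nE G)) λ e → e ∈ˡ es × Joins G e u v

  labelling-list : ∀ es → ∃ λ c → Labelling (AdjList es) c
  labelling-list [] = nV G , relabel identity-labelling (λ ()) (λ { (_ , () , _) })
  labelling-list (e ∷ es) with labelling-list es
  ... | c , L with labelling-+step L (tail G e) (head G e)
  ... | c' , L' = c' , relabel L' forth back
    where
    forth : ∀ {u v} → (AdjList es +step tail G e — head G e) u v → Star (AdjList (e ∷ es)) u v
    forth (inj₁ (f , f∈ , j)) = (f , there f∈ , j) ◅ ε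
    forth (inj₂ j)            = (e , here refl , j) ◅ ε
    back : ∀ {u v} → AdjList (e ∷ es) u v → Star (AdjList es +step tail G e — head G e) u v
    back (_ , here refl , j) = inj₂ j ◅ ε
    back (f , there f∈ , j)  = inj₁ (f , f∈ , j) ◅ ε

  numComponents : ∀ T → ∃ λ c → NumComponents G T c
  numComponents T with labelling-list (elements T)
  ... | c , L = c , relabel L (λ { (e , e∈ , j) → (e , elements⁻ T e∈ , j) ◅ ε })
                              (λ { (e , e∈ , j) → (e , elements⁺ T e∈ , j) ◅ ε })

  connected-mono : ∀ {T T'} → T ⊆ T' → ∀ {u v} → Connected G T u v → Connected G T' u v
  connected-mono T⊆T' = Star.map (λ { (e , e∈ , j) → e , T⊆T' e∈ , j })

  Separates : EdgeSet G → Set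
  Separates S = ∃₂ λ u v → Connected G ⊤ u v × ¬ Connected G (∁ S) u v

  increases⇒separates : ∀ S → IncreasesComponents G S → Separates S
  increases⇒separates S (c , c' , L , L' , c<c') = Finer.<⇒separated L L' (connected-mono (λ _ → ∈⊤)) c<c'

  separates⇒increases : ∀ S → Separates S → IncreasesComponents G S
  separates⇒increases S (u , v , u~v , ¬u~v) with numComponents ⊤ | numComponents (∁ S)
  ... | c , L | c' , L' = c , c' , L , L' , Finer.separated⇒< L L' (connected-mono (λ _ → ∈⊤)) u v u~v ¬u~v

  increases? : ∀ S → Dec (IncreasesComponents G S)
  increases? S with numComponents ⊤ | numComponents (∁ S)
  ... | _ , L | _ , L' with any? (λ u → any? (λ v → separated? u v))
    where
    separated? : ∀ u v → Dec (Connected G ⊤ u v × ¬ Connected G (∁ S) u v)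
    separated? u v = connected? L u v ×-dec ¬? (connected? L' u v)
  ... | yes (u , v , sep) = yes (separates⇒increases S (u , v , sep))
  ... | no ¬sep = no (λ inc → ¬sep (increases⇒separates S inc))

module Subsets where

  false≢true : false ≢ true
  false≢true ()

  ∈⇒lookup : ∀ {m} {p : Subset m} {i} → i ∈ p → lookup p i ≡ true
  ∈⇒lookup = []=⇒lookup

  lookup⇒∈ : ∀ {m} (p : Subset m) i → lookup p i ≡ true → i ∈ p
  lookup⇒∈ p i e = lookup⇒[]= i p e

  ∉⇒lookup : ∀ {m} (p : Subset m) i → i ∉ p → lookup p i ≡ false
  ∉⇒lookup p i i∉p with lookup p i in eq
  ... | true  = ⊥-elim (i∉p (lookup⇒∈ p i eq))
  ... | false = refl

  vec-ext : ∀ {A : Set} {m} (p q : Vec A m) → (∀ i → lookup p i ≡ lookup q i) → p ≡ q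
  vec-ext p q f = trans (sym (tabulate∘lookup p)) (trans (tabulate-cong f) (tabulate∘lookup q))

  lookup-Δ : ∀ {m} (p q : Subset m) i → lookup (p Δ q) i ≡ lookup p i xor lookup q i
  lookup-Δ p q i = lookup-zipWith _xor_ i p q

  lookup-∪ : ∀ {m} (p q : Subset m) i → lookup (p ∪ q) i ≡ lookup p i ∨ lookup q i
  lookup-∪ p q i = lookup-zipWith _∨_ i p q

  ⊂-from : ∀ {m} {p q : Subset m} → p ⊆ q → p ≢ q → p ⊂ q
  ⊂-from {m} {p} {q} p⊆q p≢q with q ⊆? p
  ... | yes q⊆p = ⊥-elim (p≢q (⊆-antisym p⊆q q⊆p))
  ... | no q⊈p with ¬∀⟶∃¬ m _ (λ i → (i ∈? q) →-dec (i ∈? p)) (λ f → q⊈p (λ {x} → f x))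
  ... | x , ¬x with x ∈? q
  ... | yes x∈q = p⊆q , x , x∈q , (λ x∈p → ¬x (λ _ → x∈p))
  ... | no x∉q  = ⊥-elim (¬x (λ x∈q → ⊥-elim (x∉q x∈q)))

  ⋃-⊇ : ∀ {m} {T : Subset m} {Ts} → T ∈ˡ Ts → T ⊆ ⋃ Ts
  ⋃-⊇ (here refl) x = x∈p∪q⁺ (inj₁ x)
  ⋃-⊇ (there t)   x = x∈p∪q⁺ (inj₂ (⋃-⊇ t x))

  ∈⋃⁻ : ∀ {m} {y : Fin m} (Ts : List (Subset m)) → y ∈ ⋃ Ts → ∃ λ T → T ∈ˡ Ts × y ∈ T
  ∈⋃⁻ []       y∈ = ⊥-elim (∉⊥ y∈)
  ∈⋃⁻ (T ∷ Ts) y∈ with x∈p∪q⁻ T (⋃ Ts) y∈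
  ... | inj₁ y∈T = T , here refl , y∈T
  ... | inj₂ y∈⋃ with ∈⋃⁻ Ts y∈⋃
  ... | T' , t , y∈T' = T' , there t , y∈T'

  disjoint-⋃ : ∀ {m} {T : Subset m} Ts → All (Disjoint T) Ts → Disjoint T (⋃ Ts)
  disjoint-⋃ Ts disj (y , y∈) with x∈p∩q⁻ _ (⋃ Ts) y∈
  ... | y∈T , y∈⋃ with ∈⋃⁻ Ts y∈⋃
  ... | T' , t , y∈T' = All.lookup disj t (y , x∈p∩q⁺ (y∈T , y∈T'))

  Δ-disjoint : ∀ {m} (A B : Subset m) → Disjoint A B → A Δ B ≡ A ∪ B
  Δ-disjoint A B disj = vec-ext _ _ λ e → trans (lookup-Δ A B e) (trans (pointwise (lookup A e) (lookup B e) refl refl) (sym (lookup-∪ A B e)))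
    where
    pointwise : ∀ {e} a b → lookup A e ≡ a → lookup B e ≡ b → a xor b ≡ a ∨ b
    pointwise {e} true true ea eb = ⊥-elim (disj (e , x∈p∩q⁺ (lookup⇒∈ A e ea , lookup⇒∈ B e eb)))
    pointwise true  false _ _ = refl
    pointwise false true  _ _ = refl
    pointwise false false _ _ = refl

  module _ {m} {C S : Subset m} (C⊆S : C ⊆ S) where
    Δ-⊆ : (S Δ C) ⊆ S
    Δ-⊆ {x} x∈ with lookup S x in eS | lookup C x in eC
    ... | true  | _     = lookup⇒∈ S x eS
    ... | false | true  = ⊥-elim (false≢true (trans (sym eS) (∈⇒lookup (C⊆S (lookup⇒∈ C x eC)))))
    ... | false | false = ⊥-elim (false≢true (trans (sym (trans (lookup-Δ S C x) (cong₂ _xor_ eS eC))) (∈⇒lookup x∈)))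

    Δ-removes : ∀ {x} → x ∈ C → x ∉ S Δ C
    Δ-removes {x} x∈C x∈SΔC with trans (sym (lookup-Δ S C x)) (∈⇒lookup x∈SΔC)
    ... | e rewrite ∈⇒lookup x∈C | ∈⇒lookup (C⊆S x∈C) with e
    ... | ()

    ∪-Δ : C ∪ (S Δ C) ≡ S
    ∪-Δ = vec-ext _ _ λ x → trans (lookup-∪ C (S Δ C) x) (trans (cong (lookup C x ∨_) (lookup-Δ S C x)) (pointwise x))
      where
      pointwise : ∀ x → lookup C x ∨ (lookup S x xor lookup C x) ≡ lookup S x
      pointwise x with lookup S x in eS | lookup C x in eC
      ... | true  | true  = refl
      ... | true  | false = refl
      ... | false | false = refl
      ... | false | true  = ⊥-elim (false≢true (trans (sym eS) (∈⇒lookup (C⊆S (lookup⇒∈ C x eC)))))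

  module Peeling {m : ℕ} (P Inv : Subset m → Set)
    (peel : ∀ S → Inv S → Nonempty S → Σ (Subset m) λ C → P C × Nonempty C × C ⊆ S × Inv (S Δ C)) where

    decompose-below : ∀ N S → ∣ S ∣ < N → Inv S → DisjointUnionOf P S
    decompose-below zero S () _
    decompose-below (suc N) S ∣S∣<N inv with nonempty? S
    ... | no empty = [] , [] , [] , sym (Empty-unique empty)
    ... | yes ne with peel S inv ne
    ... | C , pC , (x , x∈C) , C⊆S , inv' with decompose-below N (S Δ C) smaller inv'
      where
      smaller : ∣ S Δ C ∣ < N
      smaller = <-≤-trans (p⊂q⇒∣p∣<∣q∣ (Δ-⊆ C⊆S , x , C⊆S x∈C , Δ-removes C⊆S x∈C)) (≤-pred ∣S∣<N)
    ... | Ts , allP , pairwise , ⋃≡ =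
      C ∷ Ts , pC ∷ allP , disjoint ∷ pairwise , trans (cong (C ∪_) ⋃≡) (∪-Δ C⊆S)
      where
      disjoint : All (Disjoint C) Ts
      disjoint = All.tabulate λ {T} t (y , y∈) →
        let (y∈C , y∈T) = x∈p∩q⁻ C T y∈ in
        Δ-removes C⊆S y∈C (subst (y ∈_) ⋃≡ (⋃-⊇ t y∈T))

    decompose : ∀ S → Inv S → DisjointUnionOf P S
    decompose S = decompose-below (suc ∣ S ∣) S ≤-refl

module BoolFacts where

  xor≡true⇒≢ : ∀ {a b} → a xor b ≡ true → a ≢ b
  xor≡true⇒≢ {true}  {true}  () refl
  xor≡true⇒≢ {false} {false} () refl

  ≢⇒xor≡true : ∀ {a b} → a ≢ b → a xor b ≡ true
  ≢⇒xor≡true {true}  {true}  a≢b = ⊥-elim (a≢b refl)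
  ≢⇒xor≡true {true}  {false} _   = refl
  ≢⇒xor≡true {false} {true}  _   = refl
  ≢⇒xor≡true {false} {false} a≢b = ⊥-elim (a≢b refl)

  xor≡false⇒≡ : ∀ {a b} → a xor b ≡ false → a ≡ b
  xor≡false⇒≡ {true}  {true}  _ = refl
  xor≡false⇒≡ {false} {false} _ = refl
  xor≡false⇒≡ {true}  {false} ()
  xor≡false⇒≡ {false} {true}  ()

  xor-cancelʳ : ∀ {a b} c → a xor c ≡ b xor c → a ≡ b
  xor-cancelʳ {a} {b} c e = begin
    a                 ≡⟨ sym (Bool.xor-identityʳ a) ⟩
    a xor false       ≡⟨ cong (a xor_) (sym (Bool.xor-same c)) ⟩
    a xor (c xor c)   ≡⟨ sym (Bool.xor-assoc a c c) ⟩
    (a xor c) xor c   ≡⟨ cong (_xor c) e ⟩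
    (b xor c) xor c   ≡⟨ Bool.xor-assoc b c c ⟩
    b xor (c xor c)   ≡⟨ cong (b xor_) (Bool.xor-same c) ⟩
    b xor false       ≡⟨ Bool.xor-identityʳ b ⟩
    b ∎
    where open ≡-Reasoning

  xor-≢≢ : ∀ {a b c d} → a ≢ b → c ≢ d → a xor c ≡ b xor d
  xor-≢≢ {true}  {true}  a≢b _ = ⊥-elim (a≢b refl)
  xor-≢≢ {false} {false} a≢b _ = ⊥-elim (a≢b refl)
  xor-≢≢ {_} {_} {true}  {true}  _ c≢d = ⊥-elim (c≢d refl)
  xor-≢≢ {_} {_} {false} {false} _ c≢d = ⊥-elim (c≢d refl)
  xor-≢≢ {true}  {false} {true}  {false} _ _ = refl
  xor-≢≢ {true}  {false} {false} {true}  _ _ = refl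
  xor-≢≢ {false} {true}  {true}  {false} _ _ = refl
  xor-≢≢ {false} {true}  {false} {true}  _ _ = refl

  xor-interchange : ∀ a b c d → (a xor b) xor (c xor d) ≡ (a xor c) xor (b xor d)
  xor-interchange a b c d = begin
    (a xor b) xor (c xor d)   ≡⟨ Bool.xor-assoc a b (c xor d) ⟩
    a xor (b xor (c xor d))   ≡⟨ cong (a xor_) (sym (Bool.xor-assoc b c d)) ⟩
    a xor ((b xor c) xor d)   ≡⟨ cong (λ z → a xor (z xor d)) (Bool.xor-comm b c) ⟩
    a xor ((c xor b) xor d)   ≡⟨ cong (a xor_) (Bool.xor-assoc c b d) ⟩
    a xor (c xor (b xor d))   ≡⟨ sym (Bool.xor-assoc a c (b xor d)) ⟩
    (a xor c) xor (b xor d) ∎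
    where open ≡-Reasoning

-- Cuts are exactly the disjoint unions of
-- minimal cutsets, and E itself is a cut iff G has a proper 2-colouring;
-- a proper 2-colouring is then determined by its colour on one vertex of
-- each component, which gives P(G; 2) = 2 ^ c.
module Cuts (G : Graph) where
  open Counting
  open Components using (connected?)
  open GraphComponents G
  open Subsets
  open BoolFacts

  Vertex : Set
  Vertex = Fin (nV G)

  δ : (Vertex → Bool) → EdgeSet G
  δ U = tabulate (λ e → U (tail G e) xor U (head G e))

  lookup-δ : ∀ U e → lookup (δ U) e ≡ U (tail G e) xor U (head G e)
  lookup-δ U e = lookup∘tabulate _ e

  IsCut : EdgeSet G → Set
  IsCut S = ∃ λ U → δ U ≡ S

  Joins-xor : ∀ (U : Vertex → Bool) e {u w} → Joins G e u w → U (tail G e) xor U (head G e) ≡ U u xor U w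
  Joins-xor U e (inj₁ (refl , refl)) = refl
  Joins-xor U e (inj₂ (refl , refl)) = Bool.xor-comm (U (tail G e)) (U (head G e))

  Adj-sym : ∀ {T u v} → Adj G T u v → Adj G T v u
  Adj-sym (e , e∈ , inj₁ j) = e , e∈ , inj₂ j
  Adj-sym (e , e∈ , inj₂ j) = e , e∈ , inj₁ j

  constant-off-cut : ∀ U {u w} → Connected G (∁ (δ U)) u w → U u ≡ U w
  constant-off-cut U ε = refl
  constant-off-cut U (_◅_ {i = u} {j = w} (e , e∉ , j) rest) =
    trans (xor≡false⇒≡ (trans (sym (Joins-xor U e j))
                         (trans (sym (lookup-δ U e)) (∉⇒lookup (δ U) e (x∈∁p⇒x∉p e∉)))))
          (constant-off-cut U rest)

  crossing : ∀ U {x y} → U x ≡ true → U y ≡ false → Connected G ⊤ x y → Nonempty (δ U)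
  crossing U Ux Uy ε = ⊥-elim (false≢true (trans (sym Uy) Ux))
  crossing U Ux Uy (_◅_ {j = a} (e , _ , j) rest) with U a in Ua
  ... | true  = crossing U Ua Uy rest
  ... | false = e , lookup⇒∈ (δ U) e (trans (lookup-δ U e) (trans (Joins-xor U e j) (cong₂ _xor_ Ux Ua)))

  cut-increases : ∀ U → Nonempty (δ U) → IncreasesComponents G (δ U)
  cut-increases U (e , e∈) = separates⇒increases (δ U)
    (tail G e , head G e , (e , ∈⊤ , inj₁ (refl , refl)) ◅ ε ,
     λ path → xor≡true⇒≢ (trans (sym (lookup-δ U e)) (∈⇒lookup e∈)) (constant-off-cut U path))

  -- A minimal cutset S is a cut: colour by "reachable in G − S from x", where x
  -- is separated from some y by S; that cut lies inside S, is nonempty, and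
  -- increases the number of components, so by minimality it is S.
  minimal-cutset⇒cut : ∀ S → MinimalCutset G S → IsCut S
  minimal-cutset⇒cut S (_ , increases , minimal) with increases⇒separates S increases | numComponents (∁ S)
  ... | x , y , x~y , ¬x~y | _ , L = U , minimal (δ U) δU⊆S δU-nonempty (cut-increases U δU-nonempty)
    where
    U : Vertex → Bool
    U w = does (connected? L x w)
    U-const : ∀ {a b} → Connected G (∁ S) a b → U a ≡ U b
    U-const {a} {b} a~b with connected? L x a | connected? L x b
    ... | yes _  | yes _   = refl
    ... | yes xa | no ¬xb  = ⊥-elim (¬xb (xa ◅◅ a~b))
    ... | no ¬xa | yes xb  = ⊥-elim (¬xa (xb ◅◅ Star.reverse Adj-sym a~b))
    ... | no _   | no _    = refl
    Uy : U y ≡ false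
    Uy with connected? L x y
    ... | yes x~'y = ⊥-elim (¬x~y x~'y)
    ... | no _     = refl
    δU-nonempty : Nonempty (δ U)
    δU-nonempty = crossing U (dec-true (connected? L x x) ε) Uy x~y
    δU⊆S : δ U ⊆ S
    δU⊆S {f} f∈ with f ∈? S
    ... | yes f∈S = f∈S
    ... | no f∉S  = ⊥-elim (xor≡true⇒≢ (trans (sym (lookup-δ U f)) (∈⇒lookup f∈))
                                       (U-const ((f , x∉p⇒x∈∁p f∉S , inj₁ (refl , refl)) ◅ ε)))

  -- Every nonempty edge set that increases the number of components contains
  -- a minimal cutset (descend through smaller such sets while possible).
  Smaller : EdgeSet G → EdgeSet G → Set
  Smaller T T' = T' ⊆ T × T' ≢ T × Nonempty T' × IncreasesComponents G T'

  smaller? : ∀ T T' → Dec (Smaller T T')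
  smaller? T T' = (T' ⊆? T) ×-dec ¬? (Vec.≡-dec Bool._≟_ T' T) ×-dec nonempty? T' ×-dec increases? T'

  minimal-cutset-within : ∀ N T → ∣ T ∣ < N → Nonempty T → IncreasesComponents G T →
    Σ (EdgeSet G) λ S → MinimalCutset G S × S ⊆ T
  minimal-cutset-within zero T () _ _
  minimal-cutset-within (suc N) T ∣T∣<N ne inc with anySubset? (smaller? T)
  ... | yes (T' , T'⊆T , T'≢T , ne' , inc')
    with minimal-cutset-within N T' (<-≤-trans (p⊂q⇒∣p∣<∣q∣ (⊂-from T'⊆T T'≢T)) (≤-pred ∣T∣<N)) ne' inc'
  ... | S , minimal , S⊆T' = S , minimal , (λ x → T'⊆T (S⊆T' x))
  minimal-cutset-within (suc N) T ∣T∣<N ne inc | no none = T , (ne , inc , minimal) , (λ x → x)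
    where
    minimal : ∀ T' → T' ⊆ T → Nonempty T' → IncreasesComponents G T' → T' ≡ T
    minimal T' T'⊆T ne' inc' with Vec.≡-dec Bool._≟_ T' T
    ... | yes T'≡T = T'≡T
    ... | no T'≢T  = ⊥-elim (none (T' , T'⊆T , T'≢T , ne' , inc'))

  δ-xor : ∀ U W → δ (λ v → U v xor W v) ≡ δ U Δ δ W
  δ-xor U W = vec-ext _ _ λ e →
    trans (lookup-δ (λ v → U v xor W v) e)
      (trans (xor-interchange (U (tail G e)) (W (tail G e)) (U (head G e)) (W (head G e)))
             (sym (trans (lookup-Δ (δ U) (δ W) e) (cong₂ _xor_ (lookup-δ U e) (lookup-δ W e)))))

  -- Every cut is a disjoint union of minimal cutsets: peel off a minimal
  -- cutset C ⊆ δ U; C = δ W is a cut, hence so is δ U Δ C = δ (U ⊕ W).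
  cut⇒cutsets : ∀ S → IsCut S → DisjointUnionOf (MinimalCutset G) S
  cut⇒cutsets = Peeling.decompose (MinimalCutset G) IsCut peel
    where
    peel : ∀ S → IsCut S → Nonempty S → Σ (EdgeSet G) λ C → MinimalCutset G C × Nonempty C × C ⊆ S × IsCut (S Δ C)
    peel S (U , refl) ne with minimal-cutset-within (suc ∣ δ U ∣) (δ U) ≤-refl ne (cut-increases U ne)
    ... | C , minimal , C⊆δU with minimal-cutset⇒cut C minimal
    ... | W , δW≡C = C , minimal , proj₁ minimal , C⊆δU , (λ v → U v xor W v) , trans (δ-xor U W) (cong (δ U Δ_) δW≡C)

  -- Conversely a disjoint union of cuts is a cut (of the sum of the colourings).
  cutsets⇒cut : ∀ S → DisjointUnionOf (MinimalCutset G) S → IsCut S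
  cutsets⇒cut S (Ts , minimal , pairwise , refl) = union Ts minimal pairwise
    where
    union : ∀ Ts → All (MinimalCutset G) Ts → AllPairs Disjoint Ts → IsCut (⋃ Ts)
    union [] _ _ = (λ _ → false) , vec-ext _ _ (λ e → trans (lookup-δ (λ _ → false) e) (sym (lookup-replicate e false)))
    union (T ∷ Ts) (mT ∷ mTs) (disj ∷ pairwise) with minimal-cutset⇒cut T mT | union Ts mTs pairwise
    ... | W , δW≡T | U , δU≡⋃ = (λ v → W v xor U v) , (begin
      δ (λ v → W v xor U v)  ≡⟨ δ-xor W U ⟩
      δ W Δ δ U              ≡⟨ cong₂ _Δ_ δW≡T δU≡⋃ ⟩
      T Δ ⋃ Ts               ≡⟨ Δ-disjoint T (⋃ Ts) (disjoint-⋃ Ts disj) ⟩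
      T ∪ ⋃ Ts ∎)
      where open ≡-Reasoning

module TwoColourings (G : Graph) where
  open Counting
  open Cuts G
  open Subsets
  open BoolFacts

  toBool : Fin 2 → Bool
  toBool zero       = false
  toBool (suc zero) = true

  fromBool : Bool → Fin 2
  fromBool false = zero
  fromBool true  = suc zero

  toBool-injective : ∀ {x y} → toBool x ≡ toBool y → x ≡ y
  toBool-injective {zero}     {zero}     _ = refl
  toBool-injective {suc zero} {suc zero} _ = refl
  toBool-injective {zero}     {suc zero} ()
  toBool-injective {suc zero} {zero}     ()

  toBool-fromBool : ∀ a → toBool (fromBool a) ≡ a
  toBool-fromBool true  = refl
  toBool-fromBool false = refl

  colourOf : Vec (Fin 2) (nV G) → Vertex → Bool
  colourOf col v = toBool (lookup col v)

  cut⊤⇒endpoints-differ : ∀ U → δ U ≡ ⊤ → ∀ e → U (tail G e) ≢ U (head G e)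
  cut⊤⇒endpoints-differ U δU≡⊤ e = xor≡true⇒≢ (trans (sym (lookup-δ U e)) (trans (cong (λ S → lookup S e) δU≡⊤) (lookup-replicate e true)))

  proper⇒cut⊤ : ∀ col → ProperColouring G 2 col → δ (colourOf col) ≡ ⊤
  proper⇒cut⊤ col proper = vec-ext _ _ λ e → trans (lookup-δ (colourOf col) e)
    (trans (≢⇒xor≡true (λ same → proper e (toBool-injective same))) (sym (lookup-replicate e true)))

  relativeColour : (Vertex → Bool) → Vec (Fin 2) (nV G) → Vertex → Bool
  relativeColour U₀ col v = colourOf col v xor U₀ v

  -- Two proper 2-colourings agree or disagree along every edge, so their
  -- relative colour is constant on components.
  relativeColour-constant : ∀ U₀ → δ U₀ ≡ ⊤ → ∀ col → ProperColouring G 2 col →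
    ∀ {u w} → Connected G ⊤ u w → relativeColour U₀ col u ≡ relativeColour U₀ col w
  relativeColour-constant U₀ δU₀≡⊤ col proper = fold _ (λ { (e , _ , j) r → trans (step j) r }) refl
    where
    step : ∀ {e u w} → Joins G e u w → relativeColour U₀ col u ≡ relativeColour U₀ col w
    step {e} (inj₁ (refl , refl)) = xor-≢≢ (λ same → proper e (toBool-injective same)) (cut⊤⇒endpoints-differ U₀ δU₀≡⊤ e)
    step {e} (inj₂ (refl , refl)) = sym (xor-≢≢ (λ same → proper e (toBool-injective same)) (cut⊤⇒endpoints-differ U₀ δU₀≡⊤ e))

  -- Fixing one proper colouring U₀, the proper 2-colourings correspond to the
  -- subsets of components: col ↦ the components on which col differs from U₀.
  proper-count : ∀ U₀ → δ U₀ ≡ ⊤ → ∀ c → NumComponents G ⊤ c → ∀ p → ChromaticValue G 2 p → p ≡ 2 ^ c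
  proper-count U₀ δU₀≡⊤ c (comp , onto , classes) p Hp =
    size-≡ Hp (allSubsets-size c) twist (λ _ _ → tt) twist-injective untwist untwist-proper untwist-injective
    where
    rep : Fin c → Vertex
    rep i = proj₁ (onto i)
    relative : Vec (Fin 2) (nV G) → Vertex → Bool
    relative = relativeColour U₀
    relative-constant : ∀ col → ProperColouring G 2 col → ∀ {u w} → Connected G ⊤ u w → relative col u ≡ relative col w
    relative-constant = relativeColour-constant U₀ δU₀≡⊤
    twist : Vec (Fin 2) (nV G) → Subset c
    twist col = tabulate (λ i → relative col (rep i))
    relative-twist : ∀ col → ProperColouring G 2 col → ∀ v → relative col v ≡ lookup (twist col) (comp v)
    relative-twist col proper v =
      trans (relative-constant col proper (to (classes v (rep (comp v))) (sym (proj₂ (onto (comp v))))))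
            (sym (lookup∘tabulate _ (comp v)))
    twist-injective : ∀ x y → ProperColouring G 2 x → ProperColouring G 2 y → twist x ≡ twist y → x ≡ y
    twist-injective x y px py eq = vec-ext x y λ v → toBool-injective (xor-cancelʳ (U₀ v)
      (trans (relative-twist x px v) (trans (cong (λ S → lookup S (comp v)) eq) (sym (relative-twist y py v)))))
    untwist : Subset c → Vec (Fin 2) (nV G)
    untwist w = tabulate (λ v → fromBool (lookup w (comp v) xor U₀ v))
    colour-untwist : ∀ w v → colourOf (untwist w) v ≡ lookup w (comp v) xor U₀ v
    colour-untwist w v = trans (cong toBool (lookup∘tabulate _ v)) (toBool-fromBool _)
    untwist-proper : ∀ w → Unit → ProperColouring G 2 (untwist w)
    untwist-proper w _ e same = cut⊤⇒endpoints-differ U₀ δU₀≡⊤ e (xor-cancelʳ {U₀ (tail G e)} (lookup w (comp (tail G e)))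
      (trans (Bool.xor-comm (U₀ (tail G e)) _) (trans (sym (colour-untwist w (tail G e)))
        (trans (cong toBool same) (trans (colour-untwist w (head G e))
          (trans (cong (λ z → lookup w z xor U₀ (head G e)) (sym same-component)) (Bool.xor-comm _ (U₀ (head G e)))))))))
      where
      same-component : comp (tail G e) ≡ comp (head G e)
      same-component = from (classes _ _) ((e , ∈⊤ , inj₁ (refl , refl)) ◅ ε)
    untwist-injective : ∀ w w' → Unit → Unit → untwist w ≡ untwist w' → w ≡ w'
    untwist-injective w w' _ _ eq = vec-ext w w' λ i →
      subst (λ z → lookup w z ≡ lookup w' z) (proj₂ (onto i))
        (xor-cancelʳ (U₀ (rep i)) (trans (sym (colour-untwist w (rep i))) (trans (cong (λ col → colourOf col (rep i)) eq) (colour-untwist w' (rep i)))))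

  chromatic-with-⊤ : DisjointUnionOf (MinimalCutset G) ⊤ → ∀ c → NumComponents G ⊤ c → ∀ p → ChromaticValue G 2 p → p ≡ 2 ^ c
  chromatic-with-⊤ cutsets with cutsets⇒cut ⊤ cutsets
  ... | U₀ , δU₀≡⊤ = proper-count U₀ δU₀≡⊤

  chromatic-without-⊤ : ¬ DisjointUnionOf (MinimalCutset G) ⊤ → ∀ p → ChromaticValue G 2 p → p ≡ 0
  chromatic-without-⊤ ¬cutsets p Hp =
    size-empty Hp (λ col proper → ¬cutsets (subst (DisjointUnionOf (MinimalCutset G)) (proper⇒cut⊤ col proper) (cut⇒cutsets _ (colourOf col , refl))))

module Sums where
  open import Algebra.Properties.CommutativeMonoid.Sum +-0-commutativeMonoid public
    using (sum; sum-cong-≗; ∑-distrib-+; sum-init-last)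

  select : Bool → ℕ → ℕ
  select true  x = x
  select false _ = 0

  indicator : ∀ {P : Set} → Dec P → ℕ
  indicator d = select (does d) 1

  sum-zero : ∀ {n} (f : Fin n → ℕ) → (∀ i → f i ≡ 0) → sum f ≡ 0
  sum-zero {zero}  f _  = refl
  sum-zero {suc n} f f0 = cong₂ _+_ (f0 zero) (sum-zero (λ i → f (suc i)) (λ i → f0 (suc i)))

  sum-single : ∀ {n} (f : Fin n → ℕ) (a : Fin n) → (∀ i → i ≢ a → f i ≡ 0) → sum f ≡ f a
  sum-single {suc n} f zero    f0 = trans (cong (f zero +_) (sum-zero _ (λ i → f0 (suc i) (λ ())))) (+-identityʳ (f zero))
  sum-single {suc n} f (suc a) f0 = trans (cong (_+ sum (λ i → f (suc i))) (f0 zero (λ ())))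
    (sum-single (λ i → f (suc i)) a (λ i i≢a → f0 (suc i) (λ e → i≢a (suc-injective e))))

  module _ {n : ℕ} where
    image? : ∀ {k} (g : Fin k → Fin n) (e : Fin n) → Dec (∃ λ t → g t ≡ e)
    image? g e = any? (λ t → g t Fin.≟ e)

    sum-image : ∀ {k} (g : Fin k → Fin n) → (∀ {s t} → g s ≡ g t → s ≡ t) → (F : Fin n → ℕ) →
      sum (λ e → select (does (image? g e)) (F e)) ≡ sum (λ t → F (g t))
    sum-image {zero} g _ F = sum-zero _ none
      where
      none : ∀ e → select (does (image? g e)) (F e) ≡ 0
      none e with image? g e
      ... | yes (() , _)
      ... | no _ = refl
    sum-image {suc k} g g-inj F = begin
      sum (λ e → select (does (image? g e)) (F e))
        ≡⟨ sum-cong-≗ (λ e → split e (image? g e) (e Fin.≟ g zero) (image? g' e)) ⟩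
      sum (λ e → select (does (e Fin.≟ g zero)) (F e) + select (does (image? g' e)) (F e))
        ≡⟨ ∑-distrib-+ (λ e → select (does (e Fin.≟ g zero)) (F e)) (λ e → select (does (image? g' e)) (F e)) ⟩
      sum (λ e → select (does (e Fin.≟ g zero)) (F e)) + sum (λ e → select (does (image? g' e)) (F e))
        ≡⟨ cong₂ _+_ (trans (sum-single _ (g zero) off-g₀) at-g₀) (sum-image g' (λ e → suc-injective (g-inj e)) F) ⟩
      F (g zero) + sum (λ t → F (g' t)) ∎
      where
      open ≡-Reasoning
      g' : Fin k → Fin n
      g' t = g (suc t)
      -- the image of g is {g 0} ⊎ the image of g'
      split : ∀ e (d : Dec (∃ λ t → g t ≡ e)) (d₀ : Dec (e ≡ g zero)) (d' : Dec (∃ λ t → g' t ≡ e)) →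
        select (does d) (F e) ≡ select (does d₀) (F e) + select (does d') (F e)
      split e (yes _) (yes _) (no _) = sym (+-identityʳ (F e))
      split e (yes _) (no _) (yes _) = refl
      split e (yes (zero , p)) (no q) (no _) = ⊥-elim (q (sym p))
      split e (yes (suc t , p)) _ (no r) = ⊥-elim (r (t , p))
      split e (yes _) (yes refl) (yes (t , p)) with g-inj p
      ... | ()
      split e (no p) (yes refl) _ = ⊥-elim (p (zero , refl))
      split e (no p) _ (yes (t , q)) = ⊥-elim (p (suc t , q))
      split e (no _) (no _) (no _) = refl
      off-g₀ : ∀ i → i ≢ g zero → select (does (i Fin.≟ g zero)) (F i) ≡ 0
      off-g₀ i i≢ with i Fin.≟ g zero
      ... | yes p = ⊥-elim (i≢ p)
      ... | no _  = refl
      at-g₀ : select (does (g zero Fin.≟ g zero)) (F (g zero)) ≡ F (g zero)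
      at-g₀ with g zero Fin.≟ g zero
      ... | yes _ = refl
      ... | no p  = ⊥-elim (p refl)

  toℕ-csuc-< : ∀ {k} (t : Fin (suc k)) → toℕ t < k → toℕ (csuc t) ≡ suc (toℕ t)
  toℕ-csuc-< {k} t t<k = trans (toℕ-fromℕ< (m%n<n (suc (toℕ t)) (suc k))) (m<n⇒m%n≡m (s≤s t<k))

  toℕ-csuc-≡ : ∀ {k} (t : Fin (suc k)) → toℕ t ≡ k → toℕ (csuc t) ≡ 0
  toℕ-csuc-≡ {k} t t≡k = trans (toℕ-fromℕ< (m%n<n (suc (toℕ t)) (suc k))) (trans (cong (λ z → suc z % suc k) t≡k) (n%n≡0 (suc k)))

  csuc-inject₁ : ∀ {k} (t : Fin k) → csuc (Fin.inject₁ t) ≡ suc t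
  csuc-inject₁ {k} t = toℕ-injective (trans (toℕ-csuc-< (Fin.inject₁ t) (subst (_< k) (sym (toℕ-inject₁ t)) (toℕ<n t)))
    (cong suc (toℕ-inject₁ t)))

  csuc-last : ∀ k → csuc (Fin.fromℕ k) ≡ zero
  csuc-last k = toℕ-injective (toℕ-csuc-≡ (Fin.fromℕ k) (toℕ-fromℕ k))

  sum-rotate : ∀ {k} (h : Fin (suc k) → ℕ) → sum (λ t → h (csuc t)) ≡ sum h
  sum-rotate {k} h = begin
    sum (λ t → h (csuc t))
      ≡⟨ sum-init-last (λ t → h (csuc t)) ⟩
    sum (λ i → h (csuc (Fin.inject₁ i))) + h (csuc (Fin.fromℕ k))
      ≡⟨ cong₂ _+_ (sum-cong-≗ (λ i → cong h (csuc-inject₁ i))) (cong h (csuc-last k)) ⟩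
    sum (λ i → h (suc i)) + h zero
      ≡⟨ +-comm (sum (λ i → h (suc i))) (h zero) ⟩
    sum h ∎
    where open ≡-Reasoning

module Degrees (G : Graph) where
  open Sums
  open Subsets

  -- the number of endpoints of e at v (2 for a loop at v)
  endsAt : Fin (nE G) → Fin (nV G) → ℕ
  endsAt e v = indicator (tail G e Fin.≟ v) + indicator (head G e Fin.≟ v)

  degree : EdgeSet G → Fin (nV G) → ℕ
  degree S v = sum (λ e → select (lookup S e) (endsAt e v))

  Even : EdgeSet G → Set
  Even S = ∀ v → 2 ∣ degree S v

  twice-even : ∀ x → 2 ∣ x + x
  twice-even x = divides x (trans (cong (x +_) (sym (+-identityʳ x))) (*-comm 2 x))

  select-membership : ∀ {P : Set} (b : Bool) x → (b ≡ true → P) → (P → b ≡ true) → (d : Dec P) → select b x ≡ select (does d) x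
  select-membership true  x _ _ (yes _) = refl
  select-membership true  x f _ (no ¬p) = ⊥-elim (¬p (f refl))
  select-membership false x _ g (yes p) with g p
  ... | ()
  select-membership false x _ _ (no _)  = refl

  indicator-cong : ∀ {a b : Fin (nV G)} v → a ≡ b → indicator (a Fin.≟ v) ≡ indicator (b Fin.≟ v)
  indicator-cong v refl = refl

  -- Along a cycle v₀ e₀ v₁ … each edge eₜ has its endpoints at vₜ and vₜ₊₁, so the
  -- degree at v counts every visit of v twice.
  cycle-even : ∀ S → Cycle G S → Even S
  cycle-even S (k , vs , es , _ , es-inj , joins , members) v = subst (2 ∣_) (sym degree≡) (twice-even visits)
    where
    visits : ℕ
    visits = sum (λ t → indicator (vs t Fin.≟ v))
    endsAt-step : ∀ t → endsAt (es t) v ≡ indicator (vs t Fin.≟ v) + indicator (vs (csuc t) Fin.≟ v)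
    endsAt-step t with joins t
    ... | inj₁ (p , q) = cong₂ _+_ (indicator-cong v p) (indicator-cong v q)
    ... | inj₂ (p , q) = trans (cong₂ _+_ (indicator-cong v p) (indicator-cong v q))
                               (+-comm (indicator (vs (csuc t) Fin.≟ v)) (indicator (vs t Fin.≟ v)))
    open ≡-Reasoning
    degree≡ : degree S v ≡ visits + visits
    degree≡ = begin
      degree S v
        ≡⟨ sum-cong-≗ (λ e → select-membership (lookup S e) (endsAt e v)
             (λ l → to (members e) (lookup⇒∈ S e l)) (λ p → ∈⇒lookup (from (members e) p)) (image? es e)) ⟩
      sum (λ e → select (does (image? es e)) (endsAt e v))
        ≡⟨ sum-image es (λ {s} {t} → es-inj s t) (λ e → endsAt e v) ⟩
      sum (λ t → endsAt (es t) v)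
        ≡⟨ sum-cong-≗ endsAt-step ⟩
      sum (λ t → indicator (vs t Fin.≟ v) + indicator (vs (csuc t) Fin.≟ v))
        ≡⟨ ∑-distrib-+ (λ t → indicator (vs t Fin.≟ v)) (λ t → indicator (vs (csuc t) Fin.≟ v)) ⟩
      visits + sum (λ t → indicator (vs (csuc t) Fin.≟ v))
        ≡⟨ cong (visits +_) (sum-rotate (λ t → indicator (vs t Fin.≟ v))) ⟩
      visits + visits ∎

  degree-∪ : ∀ A B → Disjoint A B → ∀ v → degree (A ∪ B) v ≡ degree A v + degree B v
  degree-∪ A B disj v = trans (sum-cong-≗ pointwise) (∑-distrib-+ (λ e → select (lookup A e) (endsAt e v)) (λ e → select (lookup B e) (endsAt e v)))
    where
    pointwise : ∀ e → select (lookup (A ∪ B) e) (endsAt e v) ≡ select (lookup A e) (endsAt e v) + select (lookup B e) (endsAt e v)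
    pointwise e rewrite lookup-∪ A B e with lookup A e in eA | lookup B e in eB
    ... | true  | true  = ⊥-elim (disj (e , x∈p∩q⁺ (lookup⇒∈ A e eA , lookup⇒∈ B e eB)))
    ... | true  | false = sym (+-identityʳ _)
    ... | false | true  = refl
    ... | false | false = refl

  degree-⊥ : ∀ v → degree ⊥ v ≡ 0
  degree-⊥ v = sum-zero _ (λ e → cong (λ b → select b (endsAt e v)) (lookup-replicate e false))

  degree-⊤ : ∀ v → degree ⊤ v ≡ sum (λ e → endsAt e v)
  degree-⊤ v = sum-cong-≗ (λ e → cong (λ b → select b (endsAt e v)) (lookup-replicate e true))

  even-Δ : ∀ {C S} → C ⊆ S → Even S → Even C → Even (S Δ C)
  even-Δ {C} {S} C⊆S even-S even-C v = ∣m+n∣m⇒∣n (subst (2 ∣_) split (even-S v)) (even-C v)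
    where
    split : degree S v ≡ degree C v + degree (S Δ C) v
    split = trans (cong (λ X → degree X v) (sym (∪-Δ C⊆S)))
                  (degree-∪ C (S Δ C) (λ (x , x∈) → let (x∈C , x∈Δ) = x∈p∩q⁻ C (S Δ C) x∈ in Δ-removes C⊆S x∈C x∈Δ) v)

  cycles⇒even : ∀ S → DisjointUnionOf (Cycle G) S → Even S
  cycles⇒even S (Ts , cycles , pairwise , refl) = union Ts cycles pairwise
    where
    union : ∀ Ts → All (Cycle G) Ts → AllPairs Disjoint Ts → Even (⋃ Ts)
    union [] _ _ v = subst (2 ∣_) (sym (degree-⊥ v)) (divides 0 refl)
    union (T ∷ Ts) (cT ∷ cTs) (disj ∷ pairwise) v =
      subst (2 ∣_) (sym (degree-∪ T (⋃ Ts) (disjoint-⋃ Ts disj) v))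
        (∣m∣n⇒∣m+n (cycle-even T cT v) (union Ts cTs pairwise v))

-- From an edge of such a set S, walk through S
-- always leaving a vertex along an edge different from the one used to
-- enter it (possible by evenness); the walk segment between the first
-- repeated vertex and its earlier occurrence is a cycle C ⊆ S, and S Δ C is
-- again even, so Peeling applies.

least : (P : ℕ → Set) → (∀ j → Dec (P j)) → ∀ N → (∃ λ j → j ≤ N × P j) → ∃ λ j → P j × (∀ j' → j' < j → ¬ P j')
least P P? zero    (.zero , z≤n , p) = zero , p , (λ _ ())
least P P? (suc N) (j , j≤ , p) with any? {n = suc N} (λ t → P? (toℕ t))
... | yes (t , pt) = least P P? N (toℕ t , ≤-pred (toℕ<n t) , pt)
... | no ¬p with m≤n⇒m<n∨m≡n j≤
...   | inj₁ j<  = ⊥-elim (¬p (Fin.fromℕ< j< , subst P (sym (toℕ-fromℕ< j<)) p))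
...   | inj₂ refl = suc N , p , λ j' j'< pj' → ¬p (Fin.fromℕ< j'< , subst P (sym (toℕ-fromℕ< j'<)) pj')

module Veblen (G : Graph) where
  open Sums
  open Subsets
  open Degrees G

  Vertex : Set
  Vertex = Fin (nV G)

  Joins-unique : ∀ {e u w u' w'} → Joins G e u w → Joins G e u' w' → (u ≡ u' × w ≡ w') ⊎ (u ≡ w' × w ≡ u')
  Joins-unique (inj₁ (refl , refl)) (inj₁ (refl , refl)) = inj₁ (refl , refl)
  Joins-unique (inj₁ (refl , refl)) (inj₂ (refl , refl)) = inj₂ (refl , refl)
  Joins-unique (inj₂ (refl , refl)) (inj₁ (refl , refl)) = inj₂ (refl , refl)
  Joins-unique (inj₂ (refl , refl)) (inj₂ (refl , refl)) = inj₁ (refl , refl)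

  module Walk (S : EdgeSet G) (even : Even S) (e₀ : Fin (nE G)) (e₀∈S : e₀ ∈ S) where

    -- an edge traversed in a direction (true: from tail to head)
    Dart : Set
    Dart = Fin (nE G) × Bool

    src dst : Dart → Vertex
    src (e , true)  = tail G e
    src (e , false) = head G e
    dst (e , true)  = head G e
    dst (e , false) = tail G e

    dart-joins : ∀ d → Joins G (proj₁ d) (src d) (dst d)
    dart-joins (e , true)  = inj₁ (refl , refl)
    dart-joins (e , false) = inj₂ (refl , refl)

    Incident : Fin (nE G) → Vertex → Set
    Incident e x = tail G e ≡ x ⊎ head G e ≡ x

    Continues : Fin (nE G) → Vertex → Fin (nE G) → Set
    Continues e x e' = e' ∈ S × e' ≢ e × Incident e' x

    continues? : ∀ e x e' → Dec (Continues e x e')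
    continues? e x e' = (e' ∈? S) ×-dec (¬? (e' Fin.≟ e) ×-dec ((tail G e' Fin.≟ x) ⊎-dec (head G e' Fin.≟ x)))

    leave : ∀ {x} e' → Incident e' x → Dart
    leave e' (inj₁ _) = e' , true
    leave e' (inj₂ _) = e' , false

    src-leave : ∀ {x} e' (i : Incident e' x) → src (leave e' i) ≡ x
    src-leave e' (inj₁ p) = p
    src-leave e' (inj₂ p) = p

    nextBy : (d : Dart) → Dec (∃ (Continues (proj₁ d) (dst d))) → Dart
    nextBy d       (yes (e' , _ , _ , i)) = leave e' i
    nextBy (e , b) (no _)                 = e , not b

    next : Dart → Dart
    next d = nextBy d (any? (continues? (proj₁ d) (dst d)))

    src-nextBy : ∀ d c → src (nextBy d c) ≡ dst d
    src-nextBy d       (yes (e' , _ , _ , i)) = src-leave e' i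
    src-nextBy (e , true)  (no _) = refl
    src-nextBy (e , false) (no _) = refl

    nextBy-∈ : ∀ d c → proj₁ d ∈ S → proj₁ (nextBy d c) ∈ S
    nextBy-∈ d       (yes (e' , e'∈ , _ , inj₁ _)) _ = e'∈
    nextBy-∈ d       (yes (e' , e'∈ , _ , inj₂ _)) _ = e'∈
    nextBy-∈ (e , b) (no _) e∈ = e∈

    endsAt-dst : ∀ d → src d ≢ dst d → endsAt (proj₁ d) (dst d) ≡ 1
    endsAt-dst (e , true) loopless with tail G e Fin.≟ head G e | head G e Fin.≟ head G e
    ... | yes p | _     = ⊥-elim (loopless p)
    ... | no _  | yes _ = refl
    ... | no _  | no q  = ⊥-elim (q refl)
    endsAt-dst (e , false) loopless with tail G e Fin.≟ tail G e | head G e Fin.≟ tail G e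
    ... | yes _ | yes q = ⊥-elim (loopless q)
    ... | yes _ | no _  = refl
    ... | no p  | _     = ⊥-elim (p refl)

    -- Evenness: a walk entering x along a non-loop edge of S can continue.
    can-continue : ∀ d → proj₁ d ∈ S → src d ≢ dst d → ¬ (∀ e' → ¬ Continues (proj₁ d) (dst d) e')
    can-continue (e , b) e∈ loopless stuck = 2∤1 (subst (2 ∣_) degree≡1 (even x))
      where
      x : Vertex
      x = dst (e , b)
      2∤1 : ¬ (2 ∣ 1)
      2∤1 (divides zero ())
      2∤1 (divides (suc _) ())
      others : ∀ i → i ≢ e → select (lookup S i) (endsAt i x) ≡ 0
      others i i≢e with lookup S i in eS
      ... | false = refl
      ... | true with tail G i Fin.≟ x | head G i Fin.≟ x
      ...   | yes p | _     = ⊥-elim (stuck i (lookup⇒∈ S i eS , i≢e , inj₁ p))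
      ...   | no _  | yes q = ⊥-elim (stuck i (lookup⇒∈ S i eS , i≢e , inj₂ q))
      ...   | no _  | no _  = refl
      degree≡1 : degree S x ≡ 1
      degree≡1 = trans (sum-single _ e others) (trans (cong (λ z → select z (endsAt e x)) (∈⇒lookup e∈)) (endsAt-dst (e , b) loopless))

    nextBy-≢ : ∀ d c → proj₁ d ∈ S → src d ≢ dst d → proj₁ (nextBy d c) ≢ proj₁ d
    nextBy-≢ d (yes (e' , _ , e'≢ , inj₁ _)) _ _ = e'≢
    nextBy-≢ d (yes (e' , _ , e'≢ , inj₂ _)) _ _ = e'≢
    nextBy-≢ d (no stuck) e∈ loopless = ⊥-elim (can-continue d e∈ loopless (λ e' c → stuck (e' , c)))

    walk : ℕ → Dart
    walk zero    = e₀ , true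
    walk (suc j) = next (walk j)

    W : ℕ → Vertex
    W j = src (walk j)

    F : ℕ → Fin (nE G)
    F j = proj₁ (walk j)

    choice : ∀ j → Dec (∃ (Continues (F j) (dst (walk j))))
    choice j = any? (continues? (F j) (dst (walk j)))

    F∈S : ∀ j → F j ∈ S
    F∈S zero    = e₀∈S
    F∈S (suc j) = nextBy-∈ (walk j) (choice j) (F∈S j)

    F-joins : ∀ j → Joins G (F j) (W j) (W (suc j))
    F-joins j = subst (Joins G (F j) (W j)) (sym (src-nextBy (walk j) (choice j))) (dart-joins (walk j))

    F-turns : ∀ j → W j ≢ W (suc j) → F (suc j) ≢ F j
    F-turns j ne = nextBy-≢ (walk j) (choice j) (F∈S j) (λ e → ne (trans e (sym (src-nextBy (walk j) (choice j)))))

    Revisit : ℕ → Set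
    Revisit j = Σ (Fin j) λ t → W (toℕ t) ≡ W j

    revisit? : ∀ j → Dec (Revisit j)
    revisit? j = any? (λ t → W (toℕ t) Fin.≟ W j)

    some-revisit : ∃ λ j → j ≤ nV G × Revisit j
    some-revisit with pigeonhole (n<1+n (nV G)) (λ (t : Fin (suc (nV G))) → W (toℕ t))
    ... | i , j , i<j , eq = toℕ j , ≤-pred (toℕ<n j) , Fin.fromℕ< i<j , trans (cong W (toℕ-fromℕ< i<j)) eq

    first-revisit : ∃ λ j → Revisit j × (∀ j' → j' < j → ¬ Revisit j')
    first-revisit = least Revisit revisit? (nV G) some-revisit

    r : ℕ
    r = proj₁ first-revisit

    W-distinct : ∀ a b → a < r → b < r → W a ≡ W b → a ≡ b
    W-distinct a b a<r b<r eq with <-cmp a b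
    ... | tri< a<b _ _ = ⊥-elim (proj₂ (proj₂ first-revisit) b b<r (Fin.fromℕ< a<b , trans (cong W (toℕ-fromℕ< a<b)) eq))
    ... | tri≈ _ a≡b _ = a≡b
    ... | tri> _ _ b<a = ⊥-elim (proj₂ (proj₂ first-revisit) a a<r (Fin.fromℕ< b<a , trans (cong W (toℕ-fromℕ< b<a)) (sym eq)))

    -- Before r the walk uses no edge twice: equal edges at a < b would force
    -- W a = W b, or W (a+1) = W b and W a = W (b+1), impossible below r
    -- except for b = a + 1, which the turning rule excludes.
    F-distinct< : ∀ a b → a < b → b < r → F a ≢ F b
    F-distinct< a b a<b b<r eq with Joins-unique (F-joins a) (subst (λ z → Joins G z (W b) (W (suc b))) (sym eq) (F-joins b))
    ... | inj₁ (Wa≡Wb , _) = <⇒≢ a<b (W-distinct a b (<-trans a<b b<r) b<r Wa≡Wb)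
    ... | inj₂ (Wa≡Wb+1 , Wa+1≡Wb) with W-distinct (suc a) b (≤-<-trans a<b b<r) b<r Wa+1≡Wb
    ...   | refl with m≤n⇒m<n∨m≡n b<r
    ...     | inj₁ a+2<r = ⊥-elim (<⇒≢ (<-trans (n<1+n a) (n<1+n (suc a))) (W-distinct a (suc (suc a)) (<-trans a<b b<r) a+2<r Wa≡Wb+1))
    ...     | inj₂ _ = F-turns a (λ e → <⇒≢ (n<1+n a) (W-distinct a (suc a) (<-trans a<b b<r) b<r e)) (sym eq)

    F-distinct : ∀ a b → a < r → b < r → F a ≡ F b → a ≡ b
    F-distinct a b a<r b<r eq with <-cmp a b
    ... | tri< a<b _ _ = ⊥-elim (F-distinct< a b a<b b<r eq)
    ... | tri≈ _ a≡b _ = a≡b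
    ... | tri> _ _ b<a = ⊥-elim (F-distinct< b a b<a a<r (sym eq))

    -- The cycle runs from i₀ (the earlier visit of W r) up to r - 1.
    i₀ : ℕ
    i₀ = toℕ (proj₁ (proj₁ (proj₂ first-revisit)))

    i₀<r : i₀ < r
    i₀<r = toℕ<n (proj₁ (proj₁ (proj₂ first-revisit)))

    closes : W i₀ ≡ W r
    closes = proj₂ (proj₁ (proj₂ first-revisit))

    k : ℕ
    k = r ∸ suc i₀

    length≡ : suc (i₀ + k) ≡ r
    length≡ = m+[n∸m]≡n i₀<r

    idx : Fin (suc k) → ℕ
    idx t = i₀ + toℕ t

    idx<r : ∀ t → idx t < r
    idx<r t = subst (idx t <_) length≡ (s≤s (+-monoʳ-≤ i₀ (≤-pred (toℕ<n t))))

    idx-injective : ∀ {s t} → idx s ≡ idx t → s ≡ t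
    idx-injective {s} {t} e = toℕ-injective (+-cancelˡ-≡ i₀ (toℕ s) (toℕ t) e)

    vs : Fin (suc k) → Vertex
    vs t = W (idx t)

    es : Fin (suc k) → Fin (nE G)
    es t = F (idx t)

    W-after : ∀ t → W (suc (idx t)) ≡ vs (csuc t)
    W-after t with m≤n⇒m<n∨m≡n (≤-pred (toℕ<n t))
    ... | inj₁ t<k = cong W (trans (sym (+-suc i₀ (toℕ t))) (cong (i₀ +_) (sym (toℕ-csuc-< t t<k))))
    ... | inj₂ t≡k = trans (cong W (trans (cong (λ z → suc (i₀ + z)) t≡k) length≡))
                       (trans (sym closes) (cong W (trans (sym (+-identityʳ i₀)) (cong (i₀ +_) (sym (toℕ-csuc-≡ t t≡k))))))

    C : EdgeSet G
    C = tabulate (λ e → does (image? es e))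

    C-members : ∀ e → (e ∈ C) ⇔ (∃ λ t → es t ≡ e)
    C-members e = mk⇔
      (λ e∈ → dec-witness (image? es e) (trans (sym (lookup∘tabulate _ e)) (∈⇒lookup e∈)))
      (λ img → lookup⇒∈ C e (trans (lookup∘tabulate _ e) (dec-true (image? es e) img)))
      where
      dec-witness : ∀ {P : Set} (d : Dec P) → does d ≡ true → P
      dec-witness (yes p) _ = p
      dec-witness (no _) ()

    C-cycle : Cycle G C
    C-cycle = k , vs , es
      , (λ s t e → idx-injective (W-distinct (idx s) (idx t) (idx<r s) (idx<r t) e))
      , (λ s t e → idx-injective (F-distinct (idx s) (idx t) (idx<r s) (idx<r t) e))
      , (λ t → subst (Joins G (es t) (vs t)) (W-after t) (F-joins (idx t)))
      , C-members

    C⊆S : C ⊆ S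
    C⊆S {e} e∈ with to (C-members e) e∈
    ... | t , refl = F∈S (idx t)

    C-nonempty : Nonempty C
    C-nonempty = es zero , from (C-members (es zero)) (zero , refl)

  even⇒cycles : ∀ S → Even S → DisjointUnionOf (Cycle G) S
  even⇒cycles = Peeling.decompose (Cycle G) Even peel
    where
    peel : ∀ S → Even S → Nonempty S → Σ (EdgeSet G) λ C → Cycle G C × Nonempty C × C ⊆ S × Even (S Δ C)
    peel S even (e₀ , e₀∈S) = C , C-cycle , C-nonempty , C⊆S , even-Δ C⊆S even (cycle-even C C-cycle)
      where open Walk S even e₀ e₀∈S

-- The only nowhere-zero function E → {0, 1} is the
-- constant 1, and it is a flow iff every vertex has even degree.

module Flows (G : Graph) where
  open import Data.Integer using (+_; _-_) renaming (_+_ to _+ℤ_)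
  import Data.Integer.Properties as ℤ
  import Data.Integer.Divisibility.Signed as Signed
  open import Data.Integer.Solver using (module +-*-Solver)
  open Counting
  open Sums
  open Subsets
  open Degrees G

  ∑-cong : ∀ {m} {f g : Fin m → Data.Integer.ℤ} → (∀ i → f i ≡ g i) → ∑ f ≡ ∑ g
  ∑-cong {zero}  _  = refl
  ∑-cong {suc m} fg = cong₂ _+ℤ_ (fg zero) (∑-cong (λ i → fg (suc i)))

  ∑-indicator : ∀ {m n} (x : Fin m → Fin n) v → ∑ (λ e → ifEq (x e) v (+ 1)) ≡ + sum (λ e → indicator (x e Fin.≟ v))
  ∑-indicator {zero}  x v = refl
  ∑-indicator {suc m} x v =
    trans (cong₂ _+ℤ_ (ifEq-indicator (x zero)) (∑-indicator (λ i → x (suc i)) v)) (sym (ℤ.pos-+ (indicator (x zero Fin.≟ v)) _))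
    where
    ifEq-indicator : ∀ u → ifEq u v (+ 1) ≡ + indicator (u Fin.≟ v)
    ifEq-indicator u with u Fin.≟ v
    ... | yes _ = refl
    ... | no _  = refl

  allOnes : Vec (Fin 2) (nE G)
  allOnes = Data.Vec.replicate (nE G) (suc zero)

  outdegree indegree : Fin (nV G) → ℕ
  outdegree v = sum (λ e → indicator (tail G e Fin.≟ v))
  indegree  v = sum (λ e → indicator (head G e Fin.≟ v))

  netFlow-allOnes : ∀ v → netFlow G allOnes v ≡ + outdegree v - + indegree v
  netFlow-allOnes v = cong₂ _-_
    (trans (∑-cong (λ e → cong (λ z → ifEq (tail G e) v (+ toℕ z)) (lookup-replicate e (suc zero)))) (∑-indicator (tail G) v))
    (trans (∑-cong (λ e → cong (λ z → ifEq (head G e) v (+ toℕ z)) (lookup-replicate e (suc zero)))) (∑-indicator (head G) v))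

  degree-⊤-split : ∀ v → degree ⊤ v ≡ outdegree v + indegree v
  degree-⊤-split v = trans (degree-⊤ v) (∑-distrib-+ (λ e → indicator (tail G e Fin.≟ v)) (λ e → indicator (head G e Fin.≟ v)))

  -- 2 divides a - b iff it divides a + b, since they differ by 2b.
  2∣difference⇔2∣sum : ∀ a b → (+ 2) ∣ℤ (+ a - + b) ⇔ 2 ∣ a + b
  2∣difference⇔2∣sum a b = mk⇔
    (λ 2∣a-b → Signed.∣⇒∣ᵤ (subst ((+ 2) Signed.∣_) sum≡ (Signed.∣m∣n⇒∣m+n (Signed.∣ᵤ⇒∣ {+ 2} {+ a - + b} 2∣a-b) 2∣2b)))
    (λ 2∣a+b → Signed.∣⇒∣ᵤ (subst ((+ 2) Signed.∣_) difference≡ (Signed.∣m∣n⇒∣m-n (Signed.∣ᵤ⇒∣ {+ 2} {+ (a + b)} 2∣a+b) 2∣2b)))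
    where
    open +-*-Solver
    sum≡ : (+ a - + b) +ℤ (+ b +ℤ + b) ≡ + (a + b)
    sum≡ = trans (solve 2 (λ x y → (x :- y) :+ (y :+ y) := x :+ y) refl (+ a) (+ b)) (sym (ℤ.pos-+ a b))
    difference≡ : + (a + b) - (+ b +ℤ + b) ≡ + a - + b
    difference≡ = trans (cong (_- (+ b +ℤ + b)) (ℤ.pos-+ a b)) (solve 2 (λ x y → (x :+ y) :- (y :+ y) := x :- y) refl (+ a) (+ b))
    2∣2b : (+ 2) Signed.∣ (+ b +ℤ + b)
    2∣2b = Signed.∣ᵤ⇒∣ (subst (λ z → 2 ∣ Data.Integer.∣ z ∣) (ℤ.pos-+ b b) (twice-even b))

  allOnes-flow⇔even : (∀ v → (+ 2) ∣ℤ netFlow G allOnes v) ⇔ Even ⊤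
  allOnes-flow⇔even = mk⇔
    (λ flow v → subst (2 ∣_) (sym (degree-⊤-split v))
                  (to (2∣difference⇔2∣sum (outdegree v) (indegree v)) (subst ((+ 2) ∣ℤ_) (netFlow-allOnes v) (flow v))))
    (λ even v → subst ((+ 2) ∣ℤ_) (sym (netFlow-allOnes v))
                  (from (2∣difference⇔2∣sum (outdegree v) (indegree v)) (subst (2 ∣_) (degree-⊤-split v) (even v))))

  nowhere-zero⇒allOnes : ∀ g → NowhereZeroFlow G 2 g → g ≡ allOnes
  nowhere-zero⇒allOnes g (nonzero , _) = vec-ext g allOnes λ e → trans (is-one (lookup g e) (nonzero e)) (sym (lookup-replicate e (suc zero)))
    where
    is-one : ∀ (x : Fin 2) → toℕ x ≢ 0 → x ≡ suc zero
    is-one zero       x≢0 = ⊥-elim (x≢0 refl)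
    is-one (suc zero) _   = refl

  allOnes-nonzero : ∀ e → toℕ (lookup allOnes e) ≢ 0
  allOnes-nonzero e eq with trans (sym (cong toℕ (lookup-replicate e (suc zero)))) eq
  ... | ()

  flow-with-⊤ : DisjointUnionOf (Cycle G) ⊤ → ∀ f → FlowValue G 2 f → f ≡ 1
  flow-with-⊤ cycles f Hf = ≤-antisym
    (size≤length Hf (allOnes ∷ []) (λ x → x) (λ x nz → here (nowhere-zero⇒allOnes x nz))
      (λ x y nx ny _ → trans (nowhere-zero⇒allOnes x nx) (sym (nowhere-zero⇒allOnes y ny))))
    (length≤size (allOnes ∷ []) ([] ∷ []) Hf (λ x → x)
      (λ { (here refl) → allOnes-nonzero , from allOnes-flow⇔even (cycles⇒even ⊤ cycles) })
      (λ { (here refl) (here refl) _ → refl }))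

  flow-without-⊤ : ¬ DisjointUnionOf (Cycle G) ⊤ → ∀ f → FlowValue G 2 f → f ≡ 0
  flow-without-⊤ ¬cycles f Hf = size-empty Hf λ g nz →
    ¬cycles (Veblen.even⇒cycles G ⊤ (to allOnes-flow⇔even (subst (λ h → ∀ v → (+ 2) ∣ℤ netFlow G h v) (nowhere-zero⇒allOnes g nz) (proj₂ nz))))

open import Data.Integer using (ℤ; +_; _-_) renaming (_*_ to _*ℤ_)
import Data.Integer.Properties as ℤ
import Data.Integer.Solver

+-minus : ∀ a b → (+ (a + b)) - (+ b) ≡ + a
+-minus a b = trans (cong (_- (+ b)) (ℤ.pos-+ a b)) (solve 2 (λ x y → (x :+ y) :- y := x) refl (+ a) (+ b))
  where open Data.Integer.Solver.+-*-Solver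

module Identities (G : Graph) where
  module Cutsets = PairCount (nE G) (DisjointUnionOf (MinimalCutset G))
  module Cycles  = PairCount (nE G) (DisjointUnionOf (Cycle G))
  open ≡-Reasoning

  chromatic-identity : ∀ c → NumComponents G ⊤ c → ∀ {l₀ l₂ p} →
    HasSize (𝓛 G 0) l₀ → HasSize (𝓛 G 2) l₂ → ChromaticValue G 2 p →
    (+ (2 ^ c)) *ℤ ((+ l₀) - (+ l₂)) ≡ + (2 ^ nE G * p)
  chromatic-identity c nc {l₀} {l₂} {p} H₀ H₂ Hp with Cutsets.Q⊤? H₀
  ... | yes cutsets = begin
    (+ (2 ^ c)) *ℤ ((+ l₀) - (+ l₂))              ≡⟨ cong (λ z → (+ (2 ^ c)) *ℤ ((+ z) - (+ l₂))) (Cutsets.even-classes-with-⊤ cutsets H₀ H₂) ⟩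
    (+ (2 ^ c)) *ℤ ((+ (2 ^ nE G + l₂)) - (+ l₂)) ≡⟨ cong ((+ (2 ^ c)) *ℤ_) (+-minus (2 ^ nE G) l₂) ⟩
    (+ (2 ^ c)) *ℤ (+ (2 ^ nE G))                 ≡⟨ sym (ℤ.pos-* (2 ^ c) (2 ^ nE G)) ⟩
    + (2 ^ c * 2 ^ nE G)                          ≡⟨ cong +_ (*-comm (2 ^ c) (2 ^ nE G)) ⟩
    + (2 ^ nE G * 2 ^ c)                          ≡⟨ cong (λ z → + (2 ^ nE G * z)) (sym (TwoColourings.chromatic-with-⊤ G cutsets c nc p Hp)) ⟩
    + (2 ^ nE G * p) ∎
  ... | no ¬cutsets = begin
    (+ (2 ^ c)) *ℤ ((+ l₀) - (+ l₂))   ≡⟨ cong (λ z → (+ (2 ^ c)) *ℤ ((+ z) - (+ l₂))) (Cutsets.even-classes-without-⊤ ¬cutsets H₀ H₂) ⟩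
    (+ (2 ^ c)) *ℤ ((+ l₂) - (+ l₂))   ≡⟨ cong ((+ (2 ^ c)) *ℤ_) (ℤ.+-inverseʳ (+ l₂)) ⟩
    (+ (2 ^ c)) *ℤ + 0                  ≡⟨ ℤ.*-zeroʳ (+ (2 ^ c)) ⟩
    + 0                                 ≡⟨ cong +_ (sym (*-zeroʳ (2 ^ nE G))) ⟩
    + (2 ^ nE G * 0)                    ≡⟨ cong (λ z → + (2 ^ nE G * z)) (sym (TwoColourings.chromatic-without-⊤ G ¬cutsets p Hp)) ⟩
    + (2 ^ nE G * p) ∎

  flow-identity : ∀ {m₀ m₂ f} → HasSize (𝓛̄ G 0) m₀ → HasSize (𝓛̄ G 2) m₂ → FlowValue G 2 f →
    (+ m₀) - (+ m₂) ≡ + (2 ^ nE G * f)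
  flow-identity {m₀} {m₂} {f} K₀ K₂ Hf with Cycles.Q⊤? K₀
  ... | yes cycles = begin
    (+ m₀) - (+ m₂)                ≡⟨ cong (λ z → (+ z) - (+ m₂)) (Cycles.even-classes-with-⊤ cycles K₀ K₂) ⟩
    (+ (2 ^ nE G + m₂)) - (+ m₂)   ≡⟨ +-minus (2 ^ nE G) m₂ ⟩
    + (2 ^ nE G)                   ≡⟨ cong +_ (sym (*-identityʳ (2 ^ nE G))) ⟩
    + (2 ^ nE G * 1)               ≡⟨ cong (λ z → + (2 ^ nE G * z)) (sym (Flows.flow-with-⊤ G cycles f Hf)) ⟩
    + (2 ^ nE G * f) ∎
  ... | no ¬cycles = begin
    (+ m₀) - (+ m₂)      ≡⟨ cong (λ z → (+ z) - (+ m₂)) (Cycles.even-classes-without-⊤ ¬cycles K₀ K₂) ⟩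
    (+ m₂) - (+ m₂)      ≡⟨ ℤ.+-inverseʳ (+ m₂) ⟩
    + 0                  ≡⟨ cong +_ (sym (*-zeroʳ (2 ^ nE G))) ⟩
    + (2 ^ nE G * 0)     ≡⟨ cong (λ z → + (2 ^ nE G * z)) (sym (Flows.flow-without-⊤ G ¬cycles f Hf)) ⟩
    + (2 ^ nE G * f) ∎

theorem1p1 : (G : Graph) (c : ℕ) → NumComponents G ⊤ c →
    (l₀ l₁ l₂ l₃ m₀ m₁ m₂ m₃ p f : ℕ) →
    HasSize (𝓛 G 0) l₀ → HasSize (𝓛 G 1) l₁ → HasSize (𝓛 G 2) l₂ → HasSize (𝓛 G 3) l₃ →
    HasSize (𝓛̄ G 0) m₀ → HasSize (𝓛̄ G 1) m₁ → HasSize (𝓛̄ G 2) m₂ → HasSize (𝓛̄ G 3) m₃ →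
    ChromaticValue G 2 p → FlowValue G 2 f →
    (l₁ ≡ l₃ × (+ (2 ^ c)) *ℤ ((+ l₀) - (+ l₂)) ≡ + (2 ^ nE G * p)) ×
    (m₁ ≡ m₃ × (+ m₀) - (+ m₂) ≡ + (2 ^ nE G * f))
theorem1p1 G c nc _ _ _ _ _ _ _ _ _ _ H₀ H₁ H₂ H₃ K₀ K₁ K₂ K₃ Hp Hf =
  (Cutsets.odd-classes H₁ H₃ , chromatic-identity c nc H₀ H₂ Hp) ,
  (Cycles.odd-classes K₁ K₃ , flow-identity K₀ K₂ Hf)
  where open Identities G
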